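{- Let $k$ be a positive integer, $a=12k+2$ and $S=\{a,a+2,a+a/2\}=\{12k+2,12k+4,18k+3\}$. Then the numerical semigroup $\langle S\rangle$ is a $3$-permutation numerical semigroup.
   Context: A numerical semigroup is a submonoid $G$ of $(\mathbb{N},+,0)$ with $\mathbb{N}\setminus G$ finite; $\langle S\rangle$ is the submonoid generated by $S$. Write the elements of $G$ as $0=g_0<g_1<g_2<\cdots$. For $n\ge 1$, $G$ is an $n$-permutation numerical semigroup if $G=\langle g_1,\dots,g_n\rangle$ and for every integer $k\ge 0$ the tuple $(g_{kn+1}\bmod n,\dots,g_{kn+n}\bmod n)$ contains exactly one representative of each residue class of $\mathbb{Z}/n\mathbb{Z}$. -}

module Defs where

open import Data.Nat using (ℕ; zero; suc; _+_; _*_; _≤_; _<_; NonZero)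
open import Data.Nat.DivMod using (_mod_)
open import Data.Fin using (Fin; toℕ)
import Data.Fin as Fin
open import Data.Vec using (Vec; _∷_; []; lookup)
open import Data.Product using (Σ; _×_; ∃; ∃!)
open import Relation.Binary.PropositionalEquality using (_≡_)
open import Function using (_∘_; _⇔_)

Subsetℕ : Set₁
Subsetℕ = ℕ → Set

lincomb : (n : ℕ) → (Fin n → ℕ) → (Fin n → ℕ) → ℕ
lincomb zero    c v = 0
lincomb (suc n) c v = c Fin.zero * v Fin.zero + lincomb n (c ∘ Fin.suc) (v ∘ Fin.suc)

⟨_⟩ : {n : ℕ} → (Fin n → ℕ) → Subsetℕ
⟨_⟩ {n} v x = Σ (Fin n → ℕ) λ c → lincomb n c v ≡ x

IsNumericalSemigroup : Subsetℕ → Set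
IsNumericalSemigroup G =
  G 0 × (∀ x y → G x → G y → G (x + y)) × (∃ λ N → ∀ x → N ≤ x → G x)

Enumerates : Subsetℕ → (ℕ → ℕ) → Set
Enumerates G g = (∀ i → g i < g (suc i)) × (∀ x → G x ⇔ (∃ λ i → g i ≡ x))

IsPermutationNS : (n : ℕ) → .{{NonZero n}} → Subsetℕ → Set
IsPermutationNS n G =
  IsNumericalSemigroup G ×
  (Σ (ℕ → ℕ) λ g →
     Enumerates G g ×
     (∀ x → G x ⇔ ⟨ (λ (i : Fin n) → g (suc (toℕ i))) ⟩ x) ×
     (∀ k (r : Fin n) → ∃! _≡_ λ (i : Fin n) → g (k * n + suc (toℕ i)) mod n ≡ r))

gensS : ℕ → Fin 3 → ℕ
gensS k = lookup ((12 * k + 2) ∷ (12 * k + 4) ∷ (18 * k + 3) ∷ [])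

-- Write m = 2t + 1 with t = 3k, so that S = {2m, 2m + 2, 3m}. Splitting the coefficient of 3m by
-- parity gives ⟨S⟩ = 2H ∪ (3m + 2H) with H = ⟨m, m + 1⟩ = {qm + j ∣ j ≤ q}, so each "row"
-- [2mQ, 2m(Q + 1)) of ⟨S⟩ is an explicit concatenation of runs of consecutive members, runs of
-- members two apart, and gaps. Read the members in increasing order with an automaton remembering
-- the residues mod 3 of the current block of three. Along a run with step d ≢ 0 (mod 3) the
-- automaton only sees the length of the run modulo 3, and 3 ∣ t, so the state at the start of row Q
-- depends only on Q mod 3 within each of the ranges Q ≤ t + 2, t + 3 ≤ Q ≤ 2t + 1 and Q ≥ 2t + 2;
-- a finite check of the row transitions shows that no residue ever repeats inside a block.

module Submission where

open import Defs
open import Data.Bool using (if_then_else_; _∨_)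
open import Data.Empty using (⊥-elim)
open import Data.Fin using (Fin; toℕ; punchOut) renaming (_≟_ to _≟ᶠ_)
import Data.Fin as Fin
open import Data.Fin.Patterns using (0F; 1F; 2F)
open import Data.Fin.Properties using (toℕ-injective; toℕ-fromℕ<; all?; any?; pigeonhole; punchOut-injective) renaming (<⇒≢ to <⇒≢ᶠ)
open import Data.Nat using (ℕ; zero; suc; _+_; _*_; _∸_; _/_; _%_; _≤_; _<_; z≤n; s≤s; NonZero)
open import Data.Nat.DivMod
open import Data.Nat.Divisibility using (divides)
open import Data.Nat.Properties
open import Data.Nat.Tactic.RingSolver using (solve-∀)
open import Data.Product using (_×_; _,_; ∃; ∃₂; ∃!; proj₁)
open import Data.Sum using (_⊎_; inj₁; inj₂)
open import Data.Vec using (_∷_; []; lookup)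
open import Function using (_∘_; _⇔_; mk⇔; Equivalence)
open import Relation.Binary.Definitions using (DecidableEquality; tri<; tri≈; tri>)
open import Relation.Binary.PropositionalEquality
open import Relation.Nullary using (Dec; yes; no; does; ¬_; contradiction)
open import Relation.Nullary.Decidable using (toWitness; map′)
open import Relation.Unary using (Decidable)

infixl 5 _⊕_
infixl 6 _⊛_

_⊕_ : Fin 3 → Fin 3 → Fin 3
r ⊕ s = (toℕ r + toℕ s) mod 3

_⊛_ : Fin 3 → Fin 3 → Fin 3
r ⊛ s = (toℕ r * toℕ s) mod 3

toℕ-mod : ∀ x → toℕ (x mod 3) ≡ x % 3
toℕ-mod x = toℕ-fromℕ< _

mod-+ : ∀ x y → (x + y) mod 3 ≡ x mod 3 ⊕ y mod 3
mod-+ x y = toℕ-injective (begin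
  toℕ ((x + y) mod 3)                  ≡⟨ toℕ-mod (x + y) ⟩
  (x + y) % 3                          ≡⟨ %-distribˡ-+ x y 3 ⟩
  (x % 3 + y % 3) % 3                  ≡⟨ sym (cong₂ (λ u v → (u + v) % 3) (toℕ-mod x) (toℕ-mod y)) ⟩
  (toℕ (x mod 3) + toℕ (y mod 3)) % 3  ≡⟨ sym (toℕ-mod (toℕ (x mod 3) + toℕ (y mod 3))) ⟩
  toℕ (x mod 3 ⊕ y mod 3)              ∎)
  where open ≡-Reasoning

mod-* : ∀ x y → (x * y) mod 3 ≡ x mod 3 ⊛ y mod 3
mod-* x y = toℕ-injective (begin
  toℕ ((x * y) mod 3)                  ≡⟨ toℕ-mod (x * y) ⟩
  (x * y) % 3                          ≡⟨ %-distribˡ-* x y 3 ⟩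
  (x % 3 * (y % 3)) % 3                ≡⟨ sym (cong₂ (λ u v → (u * v) % 3) (toℕ-mod x) (toℕ-mod y)) ⟩
  (toℕ (x mod 3) * toℕ (y mod 3)) % 3  ≡⟨ sym (toℕ-mod (toℕ (x mod 3) * toℕ (y mod 3))) ⟩
  toℕ (x mod 3 ⊛ y mod 3)              ∎)
  where open ≡-Reasoning

toℕ-mod-id : ∀ r → toℕ r mod 3 ≡ r
toℕ-mod-id 0F = refl
toℕ-mod-id 1F = refl
toℕ-mod-id 2F = refl

mod-3+ : ∀ x → (3 + x) mod 3 ≡ x mod 3
mod-3+ x = trans (mod-+ 3 x) (toℕ-mod-id (x mod 3))

mod-suc : ∀ x → suc x mod 3 ≡ x mod 3 ⊕ 1F
mod-suc x = trans (cong (_mod 3) (+-comm 1 x)) (mod-+ x 1)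

mod-2+ : ∀ x → (2 + x) mod 3 ≡ x mod 3 ⊕ 2F
mod-2+ x = trans (cong (_mod 3) (+-comm 2 x)) (mod-+ x 2)

-- Reading residues in blocks of three

-- The residues read so far in the current block; broken once a residue repeats within a block.
data Block : Set where
  broken : Block
  empty  : Block
  one    : Fin 3 → Block
  two    : Fin 3 → Fin 3 → Block

push : Block → Fin 3 → Block
push broken    r = broken
push empty     r = one r
push (one a)   r = if does (a ≟ᶠ r) then broken else two a r
push (two a b) r = if does (a ≟ᶠ r) ∨ does (b ≟ᶠ r) then broken else empty

pushAP : Fin 3 → Block → Fin 3 → ℕ → Block
pushAP d σ r zero    = σ
pushAP d σ r (suc n) = pushAP d (push σ r) (r ⊕ d) n

_≟ᴮ_ : DecidableEquality Block
broken  ≟ᴮ broken  = yes refl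
empty   ≟ᴮ empty   = yes refl
one a   ≟ᴮ one b   = map′ (cong one) (λ { refl → refl }) (a ≟ᶠ b)
two a b ≟ᴮ two c d with a ≟ᶠ c | b ≟ᶠ d
... | yes refl | yes refl = yes refl
... | no a≢c   | _        = no λ { refl → a≢c refl }
... | _        | no b≢d   = no λ { refl → b≢d refl }
broken  ≟ᴮ empty   = no λ ()
broken  ≟ᴮ one _   = no λ ()
broken  ≟ᴮ two _ _ = no λ ()
empty   ≟ᴮ broken  = no λ ()
empty   ≟ᴮ one _   = no λ ()
empty   ≟ᴮ two _ _ = no λ ()
one _   ≟ᴮ broken  = no λ ()
one _   ≟ᴮ empty   = no λ ()
one _   ≟ᴮ two _ _ = no λ ()
two _ _ ≟ᴮ broken  = no λ ()
two _ _ ≟ᴮ empty   = no λ ()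
two _ _ ≟ᴮ one _   = no λ ()

pushAP-5≡2 : ∀ d → d ≢ 0F → ∀ σ r → pushAP d σ r 5 ≡ pushAP d σ r 2
pushAP-5≡2 _           _   broken    r = refl
pushAP-5≡2 0F          d≢0 _         _ = ⊥-elim (d≢0 refl)
pushAP-5≡2 (Fin.suc d) _ empty     r =
  toWitness {a? = all? λ d → all? λ r → pushAP (Fin.suc d) empty r 5 ≟ᴮ pushAP (Fin.suc d) empty r 2} _ d r
pushAP-5≡2 (Fin.suc d) _ (one a)   r =
  toWitness {a? = all? λ d → all? λ a → all? λ r → pushAP (Fin.suc d) (one a) r 5 ≟ᴮ pushAP (Fin.suc d) (one a) r 2} _ d a r
pushAP-5≡2 (Fin.suc d) _ (two a b) r =
  toWitness {a? = all? λ d → all? λ a → all? λ b → all? λ r → pushAP (Fin.suc d) (two a b) r 5 ≟ᴮ pushAP (Fin.suc d) (two a b) r 2} _ d a b r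

pushAP-periodic : ∀ d → d ≢ 0F → ∀ σ r n → pushAP d σ r (5 + n) ≡ pushAP d σ r (2 + n)
pushAP-periodic d d≢0 σ r zero    = pushAP-5≡2 d d≢0 σ r
pushAP-periodic d d≢0 σ r (suc n) = pushAP-periodic d d≢0 (push σ r) (r ⊕ d) n

rep≥2 : Fin 3 → ℕ
rep≥2 0F = 3
rep≥2 1F = 4
rep≥2 2F = 2

pushAP-reduce : ∀ d → d ≢ 0F → ∀ σ r n → 2 ≤ n → pushAP d σ r n ≡ pushAP d σ r (rep≥2 (n mod 3))
pushAP-reduce d d≢0 σ r 1 (s≤s ())
pushAP-reduce d d≢0 σ r 2 _ = refl
pushAP-reduce d d≢0 σ r 3 _ = refl
pushAP-reduce d d≢0 σ r 4 _ = refl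
pushAP-reduce d d≢0 σ r (suc (suc (suc (suc (suc n))))) _ = begin
  pushAP d σ r (5 + n)                  ≡⟨ pushAP-periodic d d≢0 σ r n ⟩
  pushAP d σ r (2 + n)                  ≡⟨ pushAP-reduce d d≢0 σ r (suc (suc n)) (s≤s (s≤s z≤n)) ⟩
  pushAP d σ r (rep≥2 ((2 + n) mod 3))  ≡⟨ cong (pushAP d σ r ∘ rep≥2) (sym (mod-3+ (2 + n))) ⟩
  pushAP d σ r (rep≥2 ((5 + n) mod 3))  ∎
  where open ≡-Reasoning

push³-unbroken : ∀ {a b c} → push (push (push empty a) b) c ≢ broken →
                 push (push (push empty a) b) c ≡ empty × a ≢ b × a ≢ c × b ≢ c
push³-unbroken {a} {b} {c} ok with a ≟ᶠ b
... | yes _ = ⊥-elim (ok refl)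
... | no a≢b with a ≟ᶠ c | b ≟ᶠ c
...   | yes _   | _       = ⊥-elim (ok refl)
...   | no _    | yes _   = ⊥-elim (ok refl)
...   | no a≢c  | no b≢c  = refl , a≢b , a≢c , b≢c

module _ (f : Fin 3 → Fin 3) (0≢1 : f 0F ≢ f 1F) (0≢2 : f 0F ≢ f 2F) (1≢2 : f 1F ≢ f 2F) where

  distinct⇒injective : ∀ {i j} → f i ≡ f j → i ≡ j
  distinct⇒injective {0F} {0F} _ = refl
  distinct⇒injective {1F} {1F} _ = refl
  distinct⇒injective {2F} {2F} _ = refl
  distinct⇒injective {0F} {1F} e = ⊥-elim (0≢1 e)
  distinct⇒injective {0F} {2F} e = ⊥-elim (0≢2 e)
  distinct⇒injective {1F} {2F} e = ⊥-elim (1≢2 e)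
  distinct⇒injective {1F} {0F} e = ⊥-elim (0≢1 (sym e))
  distinct⇒injective {2F} {0F} e = ⊥-elim (0≢2 (sym e))
  distinct⇒injective {2F} {1F} e = ⊥-elim (1≢2 (sym e))

  distinct⇒∃! : ∀ r → ∃! _≡_ λ i → f i ≡ r
  distinct⇒∃! r with any? (λ i → f i ≟ᶠ r)
  ... | yes (i , fi≡r) = i , fi≡r , λ fj≡r → distinct⇒injective (trans fi≡r (sym fj≡r))
  -- otherwise f would inject Fin 3 into the two residues other than r
  ... | no ∄i with pigeonhole (s≤s (s≤s (s≤s z≤n))) (λ i → punchOut (λ r≡fi → ∄i (i , sym r≡fi)))
  ...   | i , j , i<j , same =
    ⊥-elim (<⇒≢ᶠ i<j (distinct⇒injective (punchOut-injective (λ r≡fi → ∄i (i , sym r≡fi)) (λ r≡fj → ∄i (j , sym r≡fj)) same)))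

lincomb-+ : ∀ n (c d v : Fin n → ℕ) → lincomb n (λ i → c i + d i) v ≡ lincomb n c v + lincomb n d v
lincomb-+ zero    c d v = refl
lincomb-+ (suc n) c d v = begin
  (c 0F + d 0F) * v 0F + lincomb n (λ i → c (Fin.suc i) + d (Fin.suc i)) (v ∘ Fin.suc)
    ≡⟨ cong ((c 0F + d 0F) * v 0F +_) (lincomb-+ n (c ∘ Fin.suc) (d ∘ Fin.suc) (v ∘ Fin.suc)) ⟩
  (c 0F + d 0F) * v 0F + (lincomb n (c ∘ Fin.suc) (v ∘ Fin.suc) + lincomb n (d ∘ Fin.suc) (v ∘ Fin.suc))
    ≡⟨ lemma (c 0F) (d 0F) (v 0F) _ _ ⟩
  c 0F * v 0F + lincomb n (c ∘ Fin.suc) (v ∘ Fin.suc) + (d 0F * v 0F + lincomb n (d ∘ Fin.suc) (v ∘ Fin.suc)) ∎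
  where
  open ≡-Reasoning
  lemma : ∀ a b x p q → (a + b) * x + (p + q) ≡ a * x + p + (b * x + q)
  lemma = solve-∀

lincomb-zero : ∀ n (v : Fin n → ℕ) → lincomb n (λ _ → 0) v ≡ 0
lincomb-zero zero    v = refl
lincomb-zero (suc n) v = lincomb-zero n (v ∘ Fin.suc)

lincomb-cong : ∀ n (c v w : Fin n → ℕ) → (∀ i → v i ≡ w i) → lincomb n c v ≡ lincomb n c w
lincomb-cong zero    c v w v≗w = refl
lincomb-cong (suc n) c v w v≗w = cong₂ (λ a b → c 0F * a + b) (v≗w 0F) (lincomb-cong n (c ∘ Fin.suc) (v ∘ Fin.suc) (w ∘ Fin.suc) (v≗w ∘ Fin.suc))

unit : ∀ {n} → Fin n → Fin n → ℕ
unit Fin.zero    Fin.zero    = 1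
unit Fin.zero    (Fin.suc _) = 0
unit (Fin.suc _) Fin.zero    = 0
unit (Fin.suc i) (Fin.suc j) = unit i j

lincomb-unit : ∀ n (v : Fin n → ℕ) i → lincomb n (unit i) v ≡ v i
lincomb-unit (suc n) v Fin.zero    = trans (cong (v 0F + 0 +_) (lincomb-zero n (v ∘ Fin.suc))) (trans (+-identityʳ _) (+-identityʳ (v 0F)))
lincomb-unit (suc n) v (Fin.suc i) = lincomb-unit n (v ∘ Fin.suc) i

module _ {n : ℕ} (v : Fin n → ℕ) where

  ⟨⟩-zero : ⟨ v ⟩ 0
  ⟨⟩-zero = (λ _ → 0) , lincomb-zero n v

  ⟨⟩-+ : ∀ x y → ⟨ v ⟩ x → ⟨ v ⟩ y → ⟨ v ⟩ (x + y)
  ⟨⟩-+ x y (c , refl) (d , refl) = (λ i → c i + d i) , lincomb-+ n c d v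

  ⟨⟩-generator : ∀ i → ⟨ v ⟩ (v i)
  ⟨⟩-generator i = unit i , lincomb-unit n v i

⟨⟩-cong : ∀ {n} {v w : Fin n → ℕ} → (∀ i → v i ≡ w i) → ∀ x → ⟨ v ⟩ x ⇔ ⟨ w ⟩ x
⟨⟩-cong {n} {v} {w} v≗w x = mk⇔ (λ { (c , e) → c , trans (sym (lincomb-cong n c v w v≗w)) e })
                                  (λ { (c , e) → c , trans (lincomb-cong n c v w v≗w) e })

IsPermutationNS-resp : ∀ {n} .{{_ : NonZero n}} {G G′ : Subsetℕ} → (∀ x → G x ⇔ G′ x) → IsPermutationNS n G → IsPermutationNS n G′
IsPermutationNS-resp {G = G} {G′} G⇔G′ ((G0 , G+ , N , cofinite) , g , (g-< , G⇔img) , G⇔gen , perm) =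
  (to G0 , (λ x y a b → to (G+ x y (from a) (from b))) , N , (λ x le → to (cofinite x le))) ,
  g , (g-< , λ x → mk⇔ (Equivalence.to (G⇔img x) ∘ from) (to ∘ Equivalence.from (G⇔img x))) ,
  (λ x → mk⇔ (Equivalence.to (G⇔gen x) ∘ from) (to ∘ Equivalence.from (G⇔gen x))) , perm
  where
  to : ∀ {x} → G x → G′ x
  to {x} = Equivalence.to (G⇔G′ x)
  from : ∀ {x} → G′ x → G x
  from {x} = Equivalence.from (G⇔G′ x)

≤-by : ∀ {a b} c → a + c ≡ b → a ≤ b
≤-by {a} c refl = m≤m+n a c

t+1+i<1+2t : ∀ {t i} → i < t → t + 1 + i < suc (2 * t)
t+1+i<1+2t {t} {i} i<t with d , refl ← m≤n⇒∃[o]m+o≡n i<t = ≤-by d (lemma i d)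
  where lemma : ∀ i d → suc (suc i + d + 1 + i) + d ≡ suc (2 * (suc i + d))
        lemma = solve-∀

halve-odd : ∀ a b → 2 * a ≤ suc (2 * b) → a ≤ b
halve-odd a b le with a ≤? b
... | yes a≤b = a≤b
... | no  a≰b = contradiction le (<⇒≱ (≤-trans (≤-reflexive (lemma b)) (*-monoʳ-≤ 2 (≰⇒> a≰b))))
  where lemma : ∀ b → suc (suc (2 * b)) ≡ 2 * suc b
        lemma = solve-∀

≰-by : ∀ {a b} c → b + suc c ≡ a → ¬ a ≤ b
≰-by {a} {b} c refl = m+1+n≰m b

1+2[t+d]<2[1+2t]⇒d≤t : ∀ {t d} → suc (2 * (t + d)) < 2 * suc (2 * t) → d ≤ t
1+2[t+d]<2[1+2t]⇒d≤t {t} {d} lt with d ≤? t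
... | yes d≤t = d≤t
... | no  d≰t with e , refl ← m≤n⇒∃[o]m+o≡n (≰⇒> d≰t) = contradiction lt (≰-by (suc (2 * e)) (lemma t e))
  where lemma : ∀ t e → 2 * suc (2 * t) + suc (suc (2 * e)) ≡ suc (suc (2 * (t + (suc t + e))))
        lemma = solve-∀

halve : ∀ a b → 2 * a ≤ 2 * b → a ≤ b
halve a b = *-cancelˡ-≤ 2

halve< : ∀ a b → 2 * a < 2 * b → a < b
halve< a b = *-cancelˡ-< 2 a b

double-+ : ∀ {a b x} → 2 * a + 2 * b ≤ x → 2 * (a + b) ≤ x
double-+ {a} {b} = ≤-trans (≤-reflexive (*-distribˡ-+ 2 a b))

data Parity : ℕ → Set where
  even : ∀ h → Parity (2 * h)
  odd  : ∀ h → Parity (1 + 2 * h)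

parity : ∀ n → Parity n
parity zero    = even 0
parity (suc n) with parity n
... | even h = odd h
... | odd  h = subst Parity (lemma h) (even (suc h))
  where lemma : ∀ h → 2 * suc h ≡ suc (1 + 2 * h)
        lemma = solve-∀

-- Enumerating a decidable cofinite set in increasing order

module Enumeration {P : ℕ → Set} (P? : Decidable P) {N : ℕ} (cofinite : ∀ x → N ≤ x → P x) where

  search : ℕ → ℕ → ℕ
  search s zero    = s
  search s (suc f) with P? s
  ... | yes _ = s
  ... | no  _ = search (suc s) f

  search-≥ : ∀ s f → s ≤ search s f
  search-≥ s zero    = ≤-refl
  search-≥ s (suc f) with P? s
  ... | yes _ = ≤-refl
  ... | no  _ = ≤-trans (n≤1+n s) (search-≥ (suc s) f)

  search-P : ∀ s f → P (f + s) → P (search s f)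
  search-P s zero    p = p
  search-P s (suc f) p with P? s
  ... | yes ps = ps
  ... | no  _  = search-P (suc s) f (subst P (sym (+-suc f s)) p)

  search-min : ∀ s f y → s ≤ y → y < search s f → ¬ P y
  search-min s zero    y s≤y y<s = contradiction s≤y (<⇒≱ y<s)
  search-min s (suc f) y s≤y y<  with P? s
  ... | yes _  = contradiction s≤y (<⇒≱ y<)
  ... | no ¬ps with m≤n⇒m<n∨m≡n s≤y
  ...   | inj₁ s<y  = search-min (suc s) f y s<y y<
  ...   | inj₂ refl = ¬ps

  next : ℕ → ℕ
  next x = search (suc x) N

  next-> : ∀ x → x < next x
  next-> x = search-≥ (suc x) N

  next-P : ∀ x → P (next x)
  next-P x = search-P (suc x) N (cofinite (N + suc x) (m≤m+n N (suc x)))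

  next-min : ∀ x y → x < y → y < next x → ¬ P y
  next-min x y = search-min (suc x) N y

  next-char : ∀ x y → x < y → P y → (∀ z → x < z → z < y → ¬ P z) → next x ≡ y
  next-char x y x<y py gap with <-cmp (next x) y
  ... | tri< n<y _ _ = contradiction (next-P x) (gap (next x) (next-> x) n<y)
  ... | tri≈ _ n≡y _ = n≡y
  ... | tri> _ _ y<n = contradiction py (next-min x y x<y y<n)

  enum : ℕ → ℕ
  enum zero    = 0
  enum (suc i) = next (enum i)

  enum-< : ∀ i → enum i < enum (suc i)
  enum-< i = next-> (enum i)

  enum-P : P 0 → ∀ i → P (enum i)
  enum-P p0 zero    = p0
  enum-P p0 (suc i) = next-P (enum i)

  enum-bracket : ∀ x → ∃ λ i → enum i ≤ x × x < enum (suc i)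
  enum-bracket zero = 0 , z≤n , enum-< 0
  enum-bracket (suc x) with enum-bracket x
  ... | i , ei≤x , x<ei+1 with m≤n⇒m<n∨m≡n x<ei+1
  ...   | inj₁ sx<ei+1 = i , ≤-trans ei≤x (n≤1+n x) , sx<ei+1
  ...   | inj₂ sx≡ei+1 = suc i , ≤-reflexive (sym sx≡ei+1) , subst (_< enum (suc (suc i))) (sym sx≡ei+1) (enum-< (suc i))

  enum-surjective : ∀ x → P x → ∃ λ i → enum i ≡ x
  enum-surjective x px with enum-bracket x
  ... | i , ei≤x , x<ei+1 with m≤n⇒m<n∨m≡n ei≤x
  ...   | inj₂ ei≡x = i , ei≡x
  ...   | inj₁ ei<x = contradiction px (next-min (enum i) x ei<x x<ei+1)

  enumerates : P 0 → Enumerates P enum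
  enumerates p0 = enum-< , λ x → mk⇔ (enum-surjective x) λ { (i , refl) → enum-P p0 i }

  visit : Block → ℕ → Block
  visit σ zero = σ
  visit σ x@(suc _) with P? x
  ... | yes _ = push σ (x mod 3)
  ... | no  _ = σ

  -- the state after reading the residues of the members of P in (0, x); g₀ = 0 belongs to no block
  scan : ℕ → Block
  scan zero    = empty
  scan (suc x) = visit (scan x) x

  pushed : ℕ → Block
  pushed zero    = empty
  pushed (suc n) = push (pushed n) (enum (suc n) mod 3)

  visit-∈ : ∀ σ x → 0 < x → P x → visit σ x ≡ push σ (x mod 3)
  visit-∈ σ x@(suc _) _ px with P? x
  ... | yes _  = refl
  ... | no ¬px = contradiction px ¬px

  visit-∉ : ∀ σ x → ¬ P x → visit σ x ≡ σ
  visit-∉ σ zero      _   = refl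
  visit-∉ σ x@(suc _) ¬px with P? x
  ... | yes px = contradiction px ¬px
  ... | no  _  = refl

  visit-broken : ∀ x → visit broken x ≡ broken
  visit-broken zero = refl
  visit-broken x@(suc _) with P? x
  ... | yes _ = refl
  ... | no  _ = refl

  scan-gap : ∀ s n → (∀ i → i < n → ¬ P (s + i)) → scan (s + n) ≡ scan s
  scan-gap s zero    _    = cong scan (+-identityʳ s)
  scan-gap s (suc n) gaps = begin
    scan (s + suc n)              ≡⟨ cong scan (+-suc s n) ⟩
    visit (scan (s + n)) (s + n)  ≡⟨ visit-∉ _ (s + n) (gaps n ≤-refl) ⟩
    scan (s + n)                  ≡⟨ scan-gap s n (λ i i<n → gaps i (m<n⇒m<1+n i<n)) ⟩
    scan s                        ∎
    where open ≡-Reasoning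

  scan-run : ∀ s n → 0 < s → (∀ i → i ≤ n → P (s + i)) →
               scan (suc (s + n)) ≡ pushAP 1F (scan s) (s mod 3) (suc n)
  scan-run s zero    s>0 members = begin
    visit (scan (s + 0)) (s + 0)  ≡⟨ cong (λ z → visit (scan z) z) (+-identityʳ s) ⟩
    visit (scan s) s              ≡⟨ visit-∈ _ s s>0 (subst P (+-identityʳ s) (members 0 z≤n)) ⟩
    push (scan s) (s mod 3)       ∎
    where open ≡-Reasoning
  scan-run s (suc n) s>0 members = begin
    scan (suc (s + suc n))                                      ≡⟨ cong (scan ∘ suc) (+-suc s n) ⟩
    scan (suc (suc s + n))                                      ≡⟨ scan-run (suc s) n (s≤s z≤n) (λ i i≤n → subst P (+-suc s i) (members (suc i) (s≤s i≤n))) ⟩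
    pushAP 1F (scan (suc s)) (suc s mod 3) (suc n)              ≡⟨ cong₂ (λ σ r → pushAP 1F σ r (suc n)) (visit-∈ _ s s>0 (subst P (+-identityʳ s) (members 0 z≤n))) (mod-suc s) ⟩
    pushAP 1F (push (scan s) (s mod 3)) (s mod 3 ⊕ 1F) (suc n)  ∎
    where open ≡-Reasoning

  scan-alternating : ∀ s n → 0 < s → (∀ i → i ≤ n → P (s + 2 * i)) → (∀ i → i < n → ¬ P (suc (s + 2 * i))) →
                       scan (suc (s + 2 * n)) ≡ pushAP 2F (scan s) (s mod 3) (suc n)
  scan-alternating s zero s>0 members _ = begin
    visit (scan (s + 0)) (s + 0)  ≡⟨ cong (λ z → visit (scan z) z) (+-identityʳ s) ⟩
    visit (scan s) s              ≡⟨ visit-∈ _ s s>0 (subst P (+-identityʳ s) (members 0 z≤n)) ⟩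
    push (scan s) (s mod 3)       ∎
    where open ≡-Reasoning
  scan-alternating s (suc n) s>0 members gaps = begin
    scan (suc (s + 2 * suc n))                                  ≡⟨ cong (scan ∘ suc) (shift s n) ⟩
    scan (suc (2 + s + 2 * n))                                  ≡⟨ scan-alternating (2 + s) n (s≤s z≤n)
                                                                        (λ i i≤n → subst P (shift s i) (members (suc i) (s≤s i≤n)))
                                                                        (λ i i<n → subst (¬_ ∘ P ∘ suc) (shift s i) (gaps (suc i) (s≤s i<n))) ⟩
    pushAP 2F (scan (2 + s)) ((2 + s) mod 3) (suc n)            ≡⟨ cong₂ (λ σ r → pushAP 2F σ r (suc n)) first-pair (mod-2+ s) ⟩
    pushAP 2F (push (scan s) (s mod 3)) (s mod 3 ⊕ 2F) (suc n)  ∎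
    where
    open ≡-Reasoning
    shift : ∀ s i → s + 2 * suc i ≡ 2 + s + 2 * i
    shift = solve-∀
    first-pair : scan (2 + s) ≡ push (scan s) (s mod 3)
    first-pair = trans (visit-∉ _ (suc s) (subst (¬_ ∘ P ∘ suc) (+-identityʳ s) (gaps 0 (s≤s z≤n))))
                       (visit-∈ _ s s>0 (subst P (+-identityʳ s) (members 0 z≤n)))

  scan-enum : P 0 → ∀ n → scan (suc (enum n)) ≡ pushed n
  scan-enum p0 zero    = refl
  scan-enum p0 (suc n) = begin
    visit (scan y) y               ≡⟨ visit-∈ _ y (≤-trans (s≤s z≤n) (enum-< n)) (next-P x) ⟩
    push (scan y) (y mod 3)        ≡⟨ cong (λ σ → push σ (y mod 3)) (trans (cong scan (sym x+1+d≡y)) (scan-gap (suc x) d skipped)) ⟩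
    push (scan (suc x)) (y mod 3)  ≡⟨ cong (λ σ → push σ (y mod 3)) (scan-enum p0 n) ⟩
    push (pushed n) (y mod 3)      ∎
    where
    open ≡-Reasoning
    x = enum n
    y = next x
    d = y ∸ suc x
    x+1+d≡y : suc x + d ≡ y
    x+1+d≡y = m+[n∸m]≡n (next-> x)
    skipped : ∀ i → i < d → ¬ P (suc x + i)
    skipped i i<d = next-min x (suc x + i) (s≤s (m≤m+n x i)) (subst (suc x + i <_) x+1+d≡y (+-monoʳ-< (suc x) i<d))

  block : ℕ → Fin 3 → Fin 3
  block j i = enum (suc (toℕ i) + j * 3) mod 3

  module _ (unbroken : ∀ n → pushed n ≢ broken) where

    pushed-aligned : ∀ j → pushed (j * 3) ≡ empty
    pushed-aligned zero    = refl
    pushed-aligned (suc j) with pushed (j * 3) | pushed-aligned j | unbroken (suc j * 3)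
    ... | .empty | refl | ok = proj₁ (push³-unbroken {block j 0F} {block j 1F} {block j 2F} ok)

    block-∃! : ∀ j r → ∃! _≡_ λ i → block j i ≡ r
    block-∃! j with pushed (j * 3) | pushed-aligned j | unbroken (suc j * 3)
    ... | .empty | refl | ok with push³-unbroken {block j 0F} {block j 1F} {block j 2F} ok
    ...   | _ , 0≢1 , 0≢2 , 1≢2 = distinct⇒∃! (block j) 0≢1 0≢2 1≢2

  scan-broken : ∀ x d → scan x ≡ broken → scan (x + d) ≡ broken
  scan-broken x zero    b = trans (cong scan (+-identityʳ x)) b
  scan-broken x (suc d) b = begin
    scan (x + suc d)              ≡⟨ cong scan (+-suc x d) ⟩
    visit (scan (x + d)) (x + d)  ≡⟨ cong (λ σ → visit σ (x + d)) (scan-broken x d b) ⟩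
    visit broken (x + d)          ≡⟨ visit-broken (x + d) ⟩
    broken                        ∎
    where open ≡-Reasoning

  scan-permutation : P 0 → (∀ x → ∃ λ y → x ≤ y × scan y ≢ broken) →
                     ∀ j (r : Fin 3) → ∃! _≡_ λ (i : Fin 3) → enum (j * 3 + suc (toℕ i)) mod 3 ≡ r
  scan-permutation p0 unbounded j r with block-∃! unbroken j r
    where
    unbroken : ∀ n → pushed n ≢ broken
    unbroken n b with unbounded (suc (enum n))
    ... | y , x≤y , ok = ok (subst (λ z → scan z ≡ broken) (m+[n∸m]≡n x≤y)
                                  (scan-broken (suc (enum n)) (y ∸ suc (enum n)) (trans (scan-enum p0 n) b)))
  ... | i , bi≡r , unique = i , trans (sym (reindex i)) bi≡r , λ e → unique (trans (reindex _) e)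
    where
    reindex : ∀ i → block j i ≡ enum (j * 3 + suc (toℕ i)) mod 3
    reindex i = cong (λ z → enum z mod 3) (+-comm (suc (toℕ i)) (j * 3))

-- The semigroups ⟨m, m + 1⟩ and ⟨2m, 2m + 2, 3m⟩

module Consecutive (m : ℕ) .{{_ : NonZero m}} where

  InH : ℕ → Set
  InH y = ∃₂ λ u v → u * m + v * suc m ≡ y

  InH-intro : ∀ q j → j ≤ q → InH (q * m + j)
  InH-intro q j j≤q with d , refl ← m≤n⇒∃[o]m+o≡n j≤q = d , j , eq j d m
    where
    eq : ∀ j d m → d * m + j * suc m ≡ (j + d) * m + j
    eq = solve-∀

  InH-bound : ∀ q j → j < m → InH (q * m + j) → j ≤ q
  InH-bound q j j<m (u , v , u+v≡y) = begin
    j              ≡⟨ j≡v%m ⟩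
    v % m          ≤⟨ m%n≤m v m ⟩
    v              ≤⟨ m≤n+m v (v / m + u) ⟩
    v / m + u + v  ≡⟨ q≡ ⟨
    q              ∎
    where
    open ≤-Reasoning
    y≡ : j + q * m ≡ v + (u + v) * m
    y≡ = trans (+-comm j (q * m)) (trans (sym u+v≡y) (lemma u v m))
      where lemma : ∀ u v m → u * m + v * suc m ≡ v + (u + v) * m
            lemma = solve-∀
    j≡v%m : j ≡ v % m
    j≡v%m = begin-equality
      j                      ≡⟨ m<n⇒m%n≡m j<m ⟨
      j % m                  ≡⟨ [m+kn]%n≡m%n j q m ⟨
      (j + q * m) % m        ≡⟨ cong (_% m) y≡ ⟩
      (v + (u + v) * m) % m  ≡⟨ [m+kn]%n≡m%n v (u + v) m ⟩
      v % m                  ∎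
    q≡ : q ≡ v / m + u + v
    q≡ = begin-equality
      q                        ≡⟨ m*n/n≡m q m ⟨
      q * m / m                ≡⟨ cong (_+ q * m / m) (m<n⇒m/n≡0 j<m) ⟨
      j / m + q * m / m        ≡⟨ +-distrib-/-∣ʳ j (divides q refl) ⟨
      (j + q * m) / m          ≡⟨ cong (_/ m) y≡ ⟩
      (v + (u + v) * m) / m    ≡⟨ +-distrib-/-∣ʳ v (divides (u + v) refl) ⟩
      v / m + (u + v) * m / m  ≡⟨ cong (v / m +_) (m*n/n≡m (u + v) m) ⟩
      v / m + (u + v)          ≡⟨ +-assoc (v / m) u v ⟨
      v / m + u + v            ∎

module Semigroup (t : ℕ) where

  m : ℕ
  m = suc (2 * t)

  open Consecutive m public

  gens : Fin 3 → ℕ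
  gens = lookup (2 * m ∷ 2 * m + 2 ∷ 3 * m ∷ [])

  G : ℕ → Set
  G = ⟨ gens ⟩

  coeffs : ℕ → ℕ → ℕ → Fin 3 → ℕ
  coeffs a b c = lookup (a ∷ b ∷ c ∷ [])

  G-even : ∀ {y} → InH y → G (2 * y)
  G-even (u , v , refl) = coeffs u v 0 , lemma u v t
    where lemma : ∀ u v t → u * (2 * suc (2 * t)) + (v * (2 * suc (2 * t) + 2) + (0 * (3 * suc (2 * t)) + 0)) ≡ 2 * (u * suc (2 * t) + v * suc (suc (2 * t)))
          lemma = solve-∀

  G-odd : ∀ {y} → InH y → G (1 + 2 * (3 * t + 1 + y))
  G-odd (u , v , refl) = coeffs u v 1 , lemma u v t
    where lemma : ∀ u v t → u * (2 * suc (2 * t)) + (v * (2 * suc (2 * t) + 2) + (1 * (3 * suc (2 * t)) + 0)) ≡ 1 + 2 * (3 * t + 1 + (u * suc (2 * t) + v * suc (suc (2 * t))))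
          lemma = solve-∀

  G-cases : ∀ {x} → G x → (∃ λ y → InH y × 2 * y ≡ x) ⊎ (∃ λ y → InH y × 1 + 2 * (3 * t + 1 + y) ≡ x)
  G-cases (c , refl) with c 2F | parity (c 2F)
  ... | _ | even s = inj₁ (_ , (c 0F + 3 * s , c 1F , refl) , lemma (c 0F) (c 1F) s t)
    where lemma : ∀ a b s t → 2 * ((a + 3 * s) * suc (2 * t) + b * suc (suc (2 * t))) ≡ a * (2 * suc (2 * t)) + (b * (2 * suc (2 * t) + 2) + (2 * s * (3 * suc (2 * t)) + 0))
          lemma = solve-∀
  ... | _ | odd  s = inj₂ (_ , (c 0F + 3 * s , c 1F , refl) , lemma (c 0F) (c 1F) s t)
    where lemma : ∀ a b s t → 1 + 2 * (3 * t + 1 + ((a + 3 * s) * suc (2 * t) + b * suc (suc (2 * t)))) ≡ a * (2 * suc (2 * t)) + (b * (2 * suc (2 * t) + 2) + ((1 + 2 * s) * (3 * suc (2 * t)) + 0))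
          lemma = solve-∀

  G-even⇒ : ∀ {y} → G (2 * y) → InH y
  G-even⇒ {y} g with G-cases g
  ... | inj₁ (z , z∈H , 2z≡2y) = subst InH (*-cancelˡ-≡ z y 2 2z≡2y) z∈H
  ... | inj₂ (z , _   , odd≡2y) = contradiction (sym odd≡2y) (even≢odd y (3 * t + 1 + z))

  G-odd⇒ : ∀ {x} → G (1 + 2 * x) → ∃ λ y → InH y × 3 * t + 1 + y ≡ x
  G-odd⇒ {x} g with G-cases g
  ... | inj₁ (z , _   , even≡odd) = contradiction even≡odd (even≢odd z x)
  ... | inj₂ (z , z∈H , odd≡odd)  = z , z∈H , *-cancelˡ-≡ _ x 2 (suc-injective odd≡odd)

  row : ℕ → ℕ → ℕ
  row Q R = Q * (2 * m) + R

  row-even : ∀ Q h → 2 * (Q * m + h) ≡ row Q (2 * h)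
  row-even Q h = lemma Q h t
    where lemma : ∀ Q h t → 2 * (Q * suc (2 * t) + h) ≡ Q * (2 * suc (2 * t)) + 2 * h
          lemma = solve-∀

  row-odd : ∀ Q j → 1 + 2 * (Q * m + j) ≡ row Q (1 + 2 * j)
  row-odd Q j = lemma Q j t
    where lemma : ∀ Q j t → 1 + 2 * (Q * suc (2 * t) + j) ≡ Q * (2 * suc (2 * t)) + (1 + 2 * j)
          lemma = solve-∀

  m+2i≡ : ∀ i → m + 2 * i ≡ 1 + 2 * (t + i)
  m+2i≡ i = lemma t i
    where lemma : ∀ t i → suc (2 * t) + 2 * i ≡ 1 + 2 * (t + i)
          lemma = solve-∀

  ∈-even : ∀ {Q h} → h ≤ Q → G (row Q (2 * h))
  ∈-even {Q} {h} h≤Q = subst G (row-even Q h) (G-even (InH-intro Q h h≤Q))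

  ∈-high : ∀ {Q i} → i < Q → G (row Q (m + 2 * i))
  ∈-high {suc Q} {i} (s≤s i≤Q) = subst G (lemma Q i t) (G-odd (InH-intro Q i i≤Q))
    where lemma : ∀ Q i t → 1 + 2 * (3 * t + 1 + (Q * suc (2 * t) + i)) ≡ suc Q * (2 * suc (2 * t)) + (suc (2 * t) + 2 * i)
          lemma = solve-∀

  ∈-low : ∀ {Q i} → i + t + 3 ≤ Q → G (row Q (1 + 2 * i))
  ∈-low {Q} {i} le with d , refl ← m≤n⇒∃[o]m+o≡n le =
    subst G (lemma i d t) (G-odd (InH-intro (t + 1 + i + d) (t + 1 + i) (m≤m+n (t + 1 + i) d)))
    where lemma : ∀ i d t → 1 + 2 * (3 * t + 1 + ((t + 1 + i + d) * suc (2 * t) + (t + 1 + i))) ≡ (i + t + 3 + d) * (2 * suc (2 * t)) + (1 + 2 * i)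
          lemma = solve-∀

  even-bound : ∀ {Q h} → h < m → G (row Q (2 * h)) → h ≤ Q
  even-bound {Q} {h} h<m g = InH-bound Q h h<m (G-even⇒ {Q * m + h} (subst G (sym (row-even Q h)) g))

  high-bound : ∀ {Q i} → i ≤ t → G (row Q (m + 2 * i)) → i < Q
  high-bound {Q} {i} i≤t g with G-odd⇒ {Q * m + (t + i)} (subst G (trans (cong (row Q) (m+2i≡ i)) (sym (row-odd Q (t + i)))) g)
  high-bound {zero}  {i} i≤t g | y , _ , e = contradiction i≤t (<⇒≱ (+-cancelˡ-≤ t _ _ (≤-by (t + y) (trans (lemma t y) e))))
    where lemma : ∀ t y → t + suc t + (t + y) ≡ 3 * t + 1 + y
          lemma = solve-∀
  high-bound {suc Q} {i} i≤t g | y , y∈H , e =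
    s≤s (InH-bound Q i (s≤s (≤-trans i≤t (m≤m+n t _))) (subst InH (+-cancelˡ-≡ (3 * t + 1) y _ (trans e (lemma Q i t))) y∈H))
    where lemma : ∀ Q i t → suc Q * suc (2 * t) + (t + i) ≡ 3 * t + 1 + (Q * suc (2 * t) + i)
          lemma = solve-∀

  low-bound : ∀ {Q i} → i < t → G (row Q (1 + 2 * i)) → i + t + 3 ≤ Q
  low-bound {Q} {i} i<t g with G-odd⇒ {Q * m + i} (subst G (sym (row-odd Q i)) g)
  low-bound {zero}        {i} i<t g | y , _ , e = contradiction (≤-by (2 * t + 1 + y) (trans (lemma t y) e)) (<⇒≱ i<t)
    where lemma : ∀ t y → t + (2 * t + 1 + y) ≡ 3 * t + 1 + y
          lemma = solve-∀
  low-bound {suc zero}    {i} i<t g | y , _ , e = contradiction (+-cancelˡ-≤ m t i (≤-by y (trans (lemma t y) (trans e (cong (_+ i) (*-identityˡ m)))))) (<⇒≱ i<t)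
    where lemma : ∀ t y → suc (2 * t) + t + y ≡ 3 * t + 1 + y
          lemma = solve-∀
  low-bound {suc (suc Q)} {i} i<t g | y , y∈H , e =
    ≤-trans (≤-reflexive (lemma₁ i t)) (s≤s (s≤s (InH-bound Q (t + 1 + i) t+1+i<m (subst InH y≡ y∈H))))
    where
    lemma₁ : ∀ i t → i + t + 3 ≡ suc (suc (t + 1 + i))
    lemma₁ = solve-∀
    lemma₂ : ∀ Q i t → suc (suc Q) * suc (2 * t) + i ≡ 3 * t + 1 + (Q * suc (2 * t) + (t + 1 + i))
    lemma₂ = solve-∀
    y≡ : y ≡ Q * m + (t + 1 + i)
    y≡ = +-cancelˡ-≡ (3 * t + 1) y _ (trans e (lemma₂ Q i t))
    t+1+i<m : t + 1 + i < m
    t+1+i<m = t+1+i<1+2t i<t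

  ∈-upper : 1 ≤ t → ∀ {Q R} → 2 * t ≤ R → R ≤ suc (2 * Q) → G (row Q R)
  ∈-upper 1≤t {Q} {R} 2t≤R R≤2Q+1 with parity R
  ... | even h = ∈-even (halve-odd h Q R≤2Q+1)
  ... | odd j with i , refl ← m≤n⇒∃[o]m+o≡n (halve-odd t j 2t≤R) =
    subst G (cong (row Q) (m+2i≡ i)) (∈-high (≤-trans (+-monoˡ-≤ i 1≤t) (halve (t + i) Q (≤-pred R≤2Q+1))))

  ∈-lower : ∀ {Q R} → 2 * t + 4 + R ≤ 2 * Q → G (row Q R)
  ∈-lower {Q} {R} le with parity R
  ... | even h = ∈-even (halve h Q (m+n≤o⇒n≤o (2 * t + 4) le))
  ... | odd j with j <? t
  ...   | yes j<t = ∈-low (halve-odd (j + t + 3) Q (≤-trans (≤-reflexive (lemma j t)) (s≤s le)))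
    where lemma : ∀ j t → 2 * (j + t + 3) ≡ suc (2 * t + 4 + (1 + 2 * j))
          lemma = solve-∀
  ...   | no  j≮t with i , refl ← m≤n⇒∃[o]m+o≡n (≮⇒≥ j≮t) =
    subst G (cong (row Q) (m+2i≡ i)) (∈-high (halve (suc i) Q (≤-trans (≤-by (4 * t + 3) (lemma t i)) le)))
    where lemma : ∀ t i → 2 * suc i + (4 * t + 3) ≡ 2 * t + 4 + (1 + 2 * (t + i))
          lemma = solve-∀

  ∉-lower : ∀ {Q R} → 2 * Q < R → R ≤ 2 * t → ¬ G (row Q R)
  ∉-lower {Q} {R} 2Q<R R≤2t g with parity R
  ... | even h = contradiction (even-bound (s≤s (≤-trans (halve h t R≤2t) (m≤m+n t _))) g) (<⇒≱ (halve< Q h 2Q<R))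
  ... | odd j  = contradiction (low-bound (halve< j t R≤2t) g) (<⇒≱ (≤-trans (s≤s (halve Q j (≤-pred 2Q<R))) (≤-by (t + 2) (lemma j t))))
    where lemma : ∀ j t → suc j + (t + 2) ≡ j + t + 3
          lemma = solve-∀

  ∉-upper : 1 ≤ t → ∀ {Q R} → 2 * Q + 2 * t ≤ R → R < 2 * m → ¬ G (row Q R)
  ∉-upper 1≤t {Q} {R} lower R<2m g with parity R
  ... | even h = contradiction (even-bound (halve< h m R<2m) g)
                   (<⇒≱ (≤-trans (≤-trans (≤-reflexive (+-comm 1 Q)) (+-monoʳ-≤ Q 1≤t)) (halve (Q + t) h (double-+ {Q} {t} lower))))
  ... | odd j with i , refl ← m≤n⇒∃[o]m+o≡n (m+n≤o⇒n≤o Q (halve-odd (Q + t) j (double-+ {Q} {t} lower))) =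
    contradiction (high-bound (1+2[t+d]<2[1+2t]⇒d≤t R<2m) (subst G (cong (row Q) (sym (m+2i≡ i))) g))
                  (≤⇒≯ (+-cancelʳ-≤ t Q i (≤-trans (halve-odd (Q + t) (t + i) (double-+ {Q} {t} lower)) (≤-reflexive (+-comm t i)))))

  G-row? : ∀ Q R → R < 2 * m → Dec (G (row Q R))
  G-row? Q R R<2m with parity R
  ... | even h with h ≤? Q
  ...   | yes h≤Q = yes (∈-even h≤Q)
  ...   | no  h≰Q = no (h≰Q ∘ even-bound (halve< h m R<2m))
  G-row? Q R R<2m | odd j with j <? t
  ...   | yes j<t with j + t + 3 ≤? Q
  ...     | yes le = yes (∈-low le)
  ...     | no  nle = no (nle ∘ low-bound j<t)
  G-row? Q R R<2m | odd j | no j≮t with i , refl ← m≤n⇒∃[o]m+o≡n (≮⇒≥ j≮t) with i <? Q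
  ...     | yes i<Q = yes (subst G (cong (row Q) (m+2i≡ i)) (∈-high i<Q))
  ...     | no  i≮Q = no (i≮Q ∘ high-bound (1+2[t+d]<2[1+2t]⇒d≤t R<2m) ∘ subst G (cong (row Q) (sym (m+2i≡ i))))

  row-decomposition : ∀ x → row (x / (2 * m)) (x % (2 * m)) ≡ x
  row-decomposition x = trans (+-comm _ (x % (2 * m))) (sym (m≡m%n+[m/n]*n x (2 * m)))

  G? : Decidable G
  G? x = subst (Dec ∘ G) (row-decomposition x) (G-row? (x / (2 * m)) (x % (2 * m)) (m%n<n x (2 * m)))

  <2m⇒≤4t+1 : ∀ {R} → R < 2 * m → R ≤ 4 * t + 1
  <2m⇒≤4t+1 R<2m = ≤-pred (≤-trans R<2m (≤-reflexive (lemma t)))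
    where lemma : ∀ t → 2 * suc (2 * t) ≡ suc (4 * t + 1)
          lemma = solve-∀

  row-full : 1 ≤ t → ∀ {Q R} → 2 * t + 2 ≤ Q → R < 2 * m → G (row Q R)
  row-full 1≤t {Q} {R} le R<2m with d , refl ← m≤n⇒∃[o]m+o≡n le with R ≤? 2 * t
  ... | yes R≤2t = ∈-lower {2 * t + 2 + d} (≤-trans (+-monoʳ-≤ (2 * t + 4) R≤2t) (≤-by (2 * d) (lemma t d)))
    where lemma : ∀ t d → 2 * t + 4 + 2 * t + 2 * d ≡ 2 * (2 * t + 2 + d)
          lemma = solve-∀
  ... | no  R≰2t = ∈-upper 1≤t {2 * t + 2 + d} (<⇒≤ (≰⇒> R≰2t)) (≤-trans (<2m⇒≤4t+1 R<2m) (≤-by (2 * d + 4) (lemma t d)))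
    where lemma : ∀ t d → 4 * t + 1 + (2 * d + 4) ≡ suc (2 * (2 * t + 2 + d))
          lemma = solve-∀

  cofinite : 1 ≤ t → ∀ x → (2 * t + 2) * (2 * m) ≤ x → G x
  cofinite 1≤t x le = subst G (row-decomposition x) (row-full 1≤t Q≥ (m%n<n x (2 * m)))
    where Q≥ : 2 * t + 2 ≤ x / (2 * m)
          Q≥ = subst (_≤ x / (2 * m)) (m*n/n≡m (2 * t + 2) (2 * m)) (/-monoˡ-≤ (2 * m) le)

module Rows (t′ : ℕ) where

  t : ℕ
  t = suc t′

  open Semigroup t public
  open Enumeration G? (cofinite (s≤s z≤n)) public

  res : ℕ → ℕ → Fin 3
  res Q R = row Q R mod 3

  row-pos : ∀ {Q} R → 1 ≤ Q → 0 < row Q R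
  row-pos {suc Q} R _ = s≤s z≤n

  row-+ : ∀ Q R i → row Q R + i ≡ row Q (R + i)
  row-+ Q R i = +-assoc (Q * (2 * m)) R i

  row-suc : ∀ Q R → suc (row Q R) ≡ row Q (suc R)
  row-suc Q R = sym (+-suc (Q * (2 * m)) R)

  row-run : ∀ Q R n → 1 ≤ Q → (∀ i → i ≤ n → G (row Q (R + i))) →
            scan (row Q (suc (R + n))) ≡ pushAP 1F (scan (row Q R)) (row Q R mod 3) (suc n)
  row-run Q R n 1≤Q members = begin
    scan (row Q (suc (R + n)))                          ≡⟨ cong scan (sym (trans (cong suc (row-+ Q R n)) (row-suc Q (R + n)))) ⟩
    scan (suc (row Q R + n))                            ≡⟨ scan-run (row Q R) n (row-pos R 1≤Q) (λ i i≤n → subst G (sym (row-+ Q R i)) (members i i≤n)) ⟩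
    pushAP 1F (scan (row Q R)) (row Q R mod 3) (suc n)  ∎
    where open ≡-Reasoning

  row-alternating : ∀ Q R n → 1 ≤ Q → (∀ i → i ≤ n → G (row Q (R + 2 * i))) → (∀ i → i < n → ¬ G (row Q (suc (R + 2 * i)))) →
                    scan (row Q (suc (R + 2 * n))) ≡ pushAP 2F (scan (row Q R)) (row Q R mod 3) (suc n)
  row-alternating Q R n 1≤Q members gaps = begin
    scan (row Q (suc (R + 2 * n)))                      ≡⟨ cong scan (sym (trans (cong suc (row-+ Q R (2 * n))) (row-suc Q (R + 2 * n)))) ⟩
    scan (suc (row Q R + 2 * n))                        ≡⟨ scan-alternating (row Q R) n (row-pos R 1≤Q) (λ i i≤n → subst G (sym (row-+ Q R (2 * i))) (members i i≤n))
                                             (λ i i<n → subst (¬_ ∘ G) (sym (trans (cong suc (row-+ Q R (2 * i))) (row-suc Q (R + 2 * i)))) (gaps i i<n)) ⟩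
    pushAP 2F (scan (row Q R)) (row Q R mod 3) (suc n)  ∎
    where open ≡-Reasoning

  row-gap : ∀ Q R n → (∀ i → i < n → ¬ G (row Q (R + i))) → scan (row Q (R + n)) ≡ scan (row Q R)
  row-gap Q R n gaps = trans (cong scan (sym (row-+ Q R n))) (scan-gap (row Q R) n (λ i i<n → subst (¬_ ∘ G) (sym (row-+ Q R i)) (gaps i i<n)))

  row-end : ∀ Q → scan (row Q (2 * m)) ≡ scan (row (suc Q) 0)
  row-end Q = cong scan (trans (+-comm (Q * (2 * m)) (2 * m)) (sym (+-identityʳ (suc Q * (2 * m)))))

scan-row≤t : ∀ {t′} q d → q + d ≡ t′ → let open Rows t′ in
             scan (row (2 + q) 0) ≡ pushAP 2F (pushAP 2F (scan (row (1 + q) 0)) (res (1 + q) 0) (2 + q)) (res (1 + q) m) (1 + q)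
scan-row≤t q d refl = begin
  scan (row (2 + q) 0)                                                        ≡⟨ row-end Q ⟨
  scan (row Q (2 * m))                                                        ≡⟨ high-run ⟩
  pushAP 2F (scan (row Q m)) (res Q m) (1 + q)                                ≡⟨ cong (λ σ → pushAP 2F σ (res Q m) (1 + q)) low-run ⟩
  pushAP 2F (pushAP 2F (scan (row Q 0)) (res Q 0) (2 + q)) (res Q m) (1 + q)  ∎
  where
  open Rows (q + d)
  open ≡-Reasoning
  Q = suc q
  Q≤t : Q ≤ t
  Q≤t = s≤s (m≤m+n q d)
  low-gaps : ∀ i → i < Q → ¬ G (row Q (suc (2 * i)))
  low-gaps i i<Q g = ≰-by (i + d + 2) (lemma q d i) (low-bound {Q} {i} (≤-trans i<Q Q≤t) g)
    where lemma : ∀ q d i → suc q + suc (i + d + 2) ≡ i + suc (q + d) + 3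
          lemma = solve-∀
  lower-gap : ∀ i → i < 2 * d → ¬ G (row Q (suc (2 * Q) + i))
  lower-gap i i< = ∉-lower {Q} {suc (2 * Q) + i} (s≤s (m≤m+n _ i)) (≤-pred (≤-trans (+-monoʳ-< (suc (2 * Q)) i<) (≤-reflexive (lemma q d))))
    where lemma : ∀ q d → suc (2 * suc q) + 2 * d ≡ suc (2 * suc (q + d))
          lemma = solve-∀
  high-gaps : ∀ i → i < q → ¬ G (row Q (suc (m + 2 * i)))
  high-gaps i i<q g = ≰-by (d + i) (lemma q d i)
                        (even-bound {Q} {t + 1 + i} (t+1+i<1+2t (≤-trans (m<n⇒m<1+n i<q) Q≤t)) (subst G (cong (row Q) (lemma′ q d i)) g))
    where lemma : ∀ q d i → suc q + suc (d + i) ≡ suc (q + d) + 1 + i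
          lemma = solve-∀
          lemma′ : ∀ q d i → suc (suc (2 * suc (q + d)) + 2 * i) ≡ 2 * (suc (q + d) + 1 + i)
          lemma′ = solve-∀
  end : suc (m + 2 * q) + (2 * d + 2) ≡ 2 * m
  end = lemma q d
    where lemma : ∀ q d → suc (suc (2 * suc (q + d)) + 2 * q) + (2 * d + 2) ≡ 2 * suc (2 * suc (q + d))
          lemma = solve-∀
  upper-gap : ∀ i → i < 2 * d + 2 → ¬ G (row Q (suc (m + 2 * q) + i))
  upper-gap i i< = ∉-upper (s≤s z≤n) {Q} {suc (m + 2 * q) + i} (≤-by i (lemma q d i)) (≤-trans (+-monoʳ-< (suc (m + 2 * q)) i<) (≤-reflexive end))
    where lemma : ∀ q d i → 2 * suc q + 2 * suc (q + d) + i ≡ suc (suc (2 * suc (q + d)) + 2 * q) + i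
          lemma = solve-∀
  low-run : scan (row Q m) ≡ pushAP 2F (scan (row Q 0)) (res Q 0) (2 + q)
  low-run = begin
    scan (row Q m)                                ≡⟨ cong (scan ∘ row Q) (lemma q d) ⟩
    scan (row Q (suc (2 * Q) + 2 * d))            ≡⟨ row-gap Q (suc (2 * Q)) (2 * d) lower-gap ⟩
    scan (row Q (suc (2 * Q)))                    ≡⟨ row-alternating Q 0 Q (s≤s z≤n) (λ i i≤Q → ∈-even i≤Q) low-gaps ⟩
    pushAP 2F (scan (row Q 0)) (res Q 0) (2 + q)  ∎
    where lemma : ∀ q d → suc (2 * suc (q + d)) ≡ suc (2 * suc q) + 2 * d
          lemma = solve-∀
  high-run : scan (row Q (2 * m)) ≡ pushAP 2F (scan (row Q m)) (res Q m) (1 + q)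
  high-run = begin
    scan (row Q (2 * m))                          ≡⟨ cong (scan ∘ row Q) end ⟨
    scan (row Q (suc (m + 2 * q) + (2 * d + 2)))  ≡⟨ row-gap Q (suc (m + 2 * q)) (2 * d + 2) upper-gap ⟩
    scan (row Q (suc (m + 2 * q)))                ≡⟨ row-alternating Q m q (s≤s z≤n) (λ i i≤q → ∈-high (s≤s i≤q)) high-gaps ⟩
    pushAP 2F (scan (row Q m)) (res Q m) (1 + q)  ∎

scan-row[t+1] : ∀ t′ → let open Rows t′ in
                scan (row (2 + t) 0) ≡ pushAP 2F (pushAP 1F (pushAP 2F (scan (row (1 + t) 0)) (res (1 + t) 0) (suc t)) (res (1 + t) m) 2) (res (1 + t) (2 + m)) t
scan-row[t+1] t′ = begin
  scan (row (2 + t) 0)                                ≡⟨ row-end Q ⟨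
  scan (row Q (2 * m))                                ≡⟨ high-run ⟩
  pushAP 2F (scan (row Q (2 + m))) (res Q (2 + m)) t  ≡⟨ cong (λ σ → pushAP 2F σ (res Q (2 + m)) t) middle-run ⟩
  pushAP 2F (pushAP 1F (scan (row Q m)) (res Q m) 2) (res Q (2 + m)) t
                                                              ≡⟨ cong (λ σ → pushAP 2F (pushAP 1F σ (res Q m) 2) (res Q (2 + m)) t) low-run ⟩
  pushAP 2F (pushAP 1F (pushAP 2F (scan (row Q 0)) (res Q 0) (suc t)) (res Q m) 2) (res Q (2 + m)) t ∎
  where
  open Rows t′
  open ≡-Reasoning
  Q = suc t
  low-gaps : ∀ i → i < t → ¬ G (row Q (suc (2 * i)))
  low-gaps i i<t g = ≰-by (i + 1) (lemma t i) (low-bound {Q} {i} i<t g)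
    where lemma : ∀ t i → suc t + suc (i + 1) ≡ i + t + 3
          lemma = solve-∀
  middle-members : ∀ i → i ≤ 1 → G (row Q (m + i))
  middle-members i i≤1 = ∈-upper (s≤s z≤n) {Q} {m + i} (≤-trans (n≤1+n _) (m≤m+n m i)) (≤-trans (+-monoʳ-≤ m i≤1) (≤-by 1 (lemma t′)))
    where lemma : ∀ t′ → suc (2 * suc t′) + 1 + 1 ≡ suc (2 * suc (suc t′))
          lemma = solve-∀
  high-members : ∀ i → i ≤ t′ → G (row Q (2 + m + 2 * i))
  high-members i i≤t′ = subst G (cong (row Q) (lemma t′ i)) (∈-high {Q} {suc i} (s≤s (s≤s i≤t′)))
    where lemma : ∀ t′ i → suc (2 * suc t′) + 2 * suc i ≡ 2 + suc (2 * suc t′) + 2 * i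
          lemma = solve-∀
  high-gaps : ∀ i → i < t′ → ¬ G (row Q (suc (2 + m + 2 * i)))
  high-gaps i i<t′ g = ≰-by i (lemma t′ i) (even-bound {Q} {t + 1 + suc i} (t+1+i<1+2t (s≤s i<t′)) (subst G (cong (row Q) (lemma′ t′ i)) g))
    where lemma : ∀ t′ i → suc (suc t′) + suc i ≡ suc t′ + 1 + suc i
          lemma = solve-∀
          lemma′ : ∀ t′ i → suc (2 + suc (2 * suc t′) + 2 * i) ≡ 2 * (suc t′ + 1 + suc i)
          lemma′ = solve-∀
  low-run : scan (row Q m) ≡ pushAP 2F (scan (row Q 0)) (res Q 0) (suc t)
  low-run = row-alternating Q 0 t (s≤s z≤n) (λ i i≤t → ∈-even (m≤n⇒m≤1+n i≤t)) low-gaps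
  middle-run : scan (row Q (2 + m)) ≡ pushAP 1F (scan (row Q m)) (res Q m) 2
  middle-run = trans (cong (scan ∘ row Q ∘ suc) (+-comm 1 m)) (row-run Q m 1 (s≤s z≤n) middle-members)
  high-run : scan (row Q (2 * m)) ≡ pushAP 2F (scan (row Q (2 + m))) (res Q (2 + m)) t
  high-run = trans (cong (scan ∘ row Q) (sym (lemma t′))) (row-alternating Q (2 + m) t′ (s≤s z≤n) high-members high-gaps)
    where lemma : ∀ t′ → suc (2 + suc (2 * suc t′) + 2 * t′) ≡ 2 * suc (2 * suc t′)
          lemma = solve-∀

scan-row[t+2] : ∀ t″ → let open Rows (suc t″) in
                scan (row (3 + t) 0) ≡ pushAP 2F (pushAP 1F (pushAP 2F (scan (row (2 + t) 0)) (res (2 + t) 0) (suc t)) (res (2 + t) m) 4) (res (2 + t) (4 + m)) (suc t″)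
scan-row[t+2] t″ = begin
  scan (row (3 + t) 0)                                       ≡⟨ row-end Q ⟨
  scan (row Q (2 * m))                                       ≡⟨ high-run ⟩
  pushAP 2F (scan (row Q (4 + m))) (res Q (4 + m)) (suc t″)  ≡⟨ cong (λ σ → pushAP 2F σ (res Q (4 + m)) (suc t″)) middle-run ⟩
  pushAP 2F (pushAP 1F (scan (row Q m)) (res Q m) 4) (res Q (4 + m)) (suc t″)
                                                              ≡⟨ cong (λ σ → pushAP 2F (pushAP 1F σ (res Q m) 4) (res Q (4 + m)) (suc t″)) low-run ⟩
  pushAP 2F (pushAP 1F (pushAP 2F (scan (row Q 0)) (res Q 0) (suc t)) (res Q m) 4) (res Q (4 + m)) (suc t″) ∎
  where
  open Rows (suc t″)
  open ≡-Reasoning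
  Q = 2 + t
  low-gaps : ∀ i → i < t → ¬ G (row Q (suc (2 * i)))
  low-gaps i i<t g = ≰-by i (lemma t i) (low-bound {Q} {i} i<t g)
    where lemma : ∀ t i → 2 + t + suc i ≡ i + t + 3
          lemma = solve-∀
  middle-members : ∀ i → i ≤ 3 → G (row Q (m + i))
  middle-members i i≤3 = ∈-upper (s≤s z≤n) {Q} {m + i} (≤-trans (n≤1+n _) (m≤m+n m i)) (≤-trans (+-monoʳ-≤ m i≤3) (≤-by 1 (lemma t″)))
    where lemma : ∀ t″ → suc (2 * suc (suc t″)) + 3 + 1 ≡ suc (2 * (2 + suc (suc t″)))
          lemma = solve-∀
  high-members : ∀ i → i ≤ t″ → G (row Q (4 + m + 2 * i))
  high-members i i≤t″ = subst G (cong (row Q) (lemma t″ i)) (∈-high {Q} {2 + i} (s≤s (s≤s (s≤s (m≤n⇒m≤1+n i≤t″)))))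
    where lemma : ∀ t″ i → suc (2 * suc (suc t″)) + 2 * (2 + i) ≡ 4 + suc (2 * suc (suc t″)) + 2 * i
          lemma = solve-∀
  high-gaps : ∀ i → i < t″ → ¬ G (row Q (suc (4 + m + 2 * i)))
  high-gaps i i<t″ g = ≰-by i (lemma t″ i) (even-bound {Q} {t + 1 + (2 + i)} (t+1+i<1+2t (s≤s (s≤s i<t″))) (subst G (cong (row Q) (lemma′ t″ i)) g))
    where lemma : ∀ t″ i → 2 + suc (suc t″) + suc i ≡ suc (suc t″) + 1 + (2 + i)
          lemma = solve-∀
          lemma′ : ∀ t″ i → suc (4 + suc (2 * suc (suc t″)) + 2 * i) ≡ 2 * (suc (suc t″) + 1 + (2 + i))
          lemma′ = solve-∀
  low-run : scan (row Q m) ≡ pushAP 2F (scan (row Q 0)) (res Q 0) (suc t)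
  low-run = row-alternating Q 0 t (s≤s z≤n) (λ i i≤t → ∈-even (≤-trans i≤t (m≤n+m t 2))) low-gaps
  middle-run : scan (row Q (4 + m)) ≡ pushAP 1F (scan (row Q m)) (res Q m) 4
  middle-run = trans (cong (scan ∘ row Q ∘ suc) (+-comm 3 m)) (row-run Q m 3 (s≤s z≤n) middle-members)
  high-run : scan (row Q (2 * m)) ≡ pushAP 2F (scan (row Q (4 + m))) (res Q (4 + m)) (suc t″)
  high-run = trans (cong (scan ∘ row Q) (sym (lemma t″))) (row-alternating Q (4 + m) t″ (s≤s z≤n) high-members high-gaps)
    where lemma : ∀ t″ → suc (4 + suc (2 * suc (suc t″)) + 2 * t″) ≡ 2 * suc (2 * suc (suc t″))
          lemma = solve-∀

scan-row[t+3+w] : ∀ {t′} w e → w + 2 + e ≡ t′ → let open Rows t′ in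
                  let Q = t + 3 + w in
                  scan (row (suc Q) 0) ≡
                    pushAP 2F (pushAP 1F (pushAP 2F (pushAP 1F (scan (row Q 0)) (res Q 0) (suc (2 * w + 1)))
                                                    (res Q (suc (2 * w + 1))) (3 + e))
                                         (res Q m) (suc (2 * w + 5)))
                              (res Q (suc (m + (2 * w + 5)))) (suc e)
scan-row[t+3+w] w e refl = begin
  scan (row (suc Q) 0)                            ≡⟨ row-end Q ⟨
  scan (row Q (2 * m))                            ≡⟨ high-run ⟩
  pushAP 2F (scan (row Q R₄)) (res Q R₄) (suc e)  ≡⟨ cong (λ σ → pushAP 2F σ (res Q R₄) (suc e)) middle-run ⟩
  pushAP 2F (pushAP 1F (scan (row Q m)) (res Q m) (suc (2 * w + 5))) (res Q R₄) (suc e)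
                                                        ≡⟨ cong (λ σ → pushAP 2F (pushAP 1F σ (res Q m) (suc (2 * w + 5))) (res Q R₄) (suc e)) even-run ⟩
  pushAP 2F (pushAP 1F (pushAP 2F (scan (row Q R₁)) (res Q R₁) (3 + e)) (res Q m) (suc (2 * w + 5))) (res Q R₄) (suc e)
                                                        ≡⟨ cong (λ σ → pushAP 2F (pushAP 1F (pushAP 2F σ (res Q R₁) (3 + e)) (res Q m) (suc (2 * w + 5))) (res Q R₄) (suc e)) low-run ⟩
  pushAP 2F (pushAP 1F (pushAP 2F (pushAP 1F (scan (row Q 0)) (res Q 0) (suc (2 * w + 1))) (res Q R₁) (3 + e)) (res Q m) (suc (2 * w + 5)))
            (res Q R₄) (suc e) ∎
  where
  open Rows (w + 2 + e)
  open ≡-Reasoning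
  Q = t + 3 + w
  R₁ = suc (2 * w + 1)
  R₄ = suc (m + (2 * w + 5))
  low-members : ∀ i → i ≤ 2 * w + 1 → G (row Q i)
  low-members i i≤ = ∈-lower {Q} {i} (≤-trans (+-monoʳ-≤ (2 * t + 4) i≤) (≤-by 1 (lemma w e)))
    where lemma : ∀ w e → 2 * suc (w + 2 + e) + 4 + (2 * w + 1) + 1 ≡ 2 * (suc (w + 2 + e) + 3 + w)
          lemma = solve-∀
  even-members : ∀ i → i ≤ 2 + e → G (row Q (R₁ + 2 * i))
  even-members i i≤ = subst G (cong (row Q) (lemma w i)) (∈-even {Q} {w + 1 + i} (≤-trans (+-monoʳ-≤ (w + 1) i≤) (≤-by (3 + w) (lemma′ w e))))
    where lemma : ∀ w i → 2 * (w + 1 + i) ≡ suc (2 * w + 1) + 2 * i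
          lemma = solve-∀
          lemma′ : ∀ w e → w + 1 + (2 + e) + (3 + w) ≡ suc (w + 2 + e) + 3 + w
          lemma′ = solve-∀
  low-gaps : ∀ i → i < 2 + e → ¬ G (row Q (suc (R₁ + 2 * i)))
  low-gaps i i< g = ≰-by i (lemma w e i)
                      (low-bound {Q} {w + 1 + i} (≤-trans (+-monoʳ-< (w + 1) i<) (≤-reflexive (lemma′ w e))) (subst G (cong (row Q) (lemma″ w i)) g))
    where lemma : ∀ w e i → suc (w + 2 + e) + 3 + w + suc i ≡ w + 1 + i + suc (w + 2 + e) + 3
          lemma = solve-∀
          lemma′ : ∀ w e → w + 1 + (2 + e) ≡ suc (w + 2 + e)
          lemma′ = solve-∀
          lemma″ : ∀ w i → suc (suc (2 * w + 1) + 2 * i) ≡ 1 + 2 * (w + 1 + i)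
          lemma″ = solve-∀
  middle-members : ∀ i → i ≤ 2 * w + 5 → G (row Q (m + i))
  middle-members i i≤ = ∈-upper (s≤s z≤n) {Q} {m + i} (≤-trans (n≤1+n _) (m≤m+n m i)) (≤-trans (+-monoʳ-≤ m i≤) (≤-by 1 (lemma w e)))
    where lemma : ∀ w e → suc (2 * suc (w + 2 + e)) + (2 * w + 5) + 1 ≡ suc (2 * (suc (w + 2 + e) + 3 + w))
          lemma = solve-∀
  high-members : ∀ i → i ≤ e → G (row Q (R₄ + 2 * i))
  high-members i i≤e = subst G (cong (row Q) (lemma w e i)) (∈-high {Q} {w + 3 + i} (≤-trans (s≤s (+-monoʳ-≤ (w + 3) i≤e)) (≤-by (2 + w) (lemma′ w e))))
    where lemma : ∀ w e i → suc (2 * suc (w + 2 + e)) + 2 * (w + 3 + i) ≡ suc (suc (2 * suc (w + 2 + e)) + (2 * w + 5)) + 2 * i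
          lemma = solve-∀
          lemma′ : ∀ w e → suc (w + 3 + e) + (2 + w) ≡ suc (w + 2 + e) + 3 + w
          lemma′ = solve-∀
  high-gaps : ∀ i → i < e → ¬ G (row Q (suc (R₄ + 2 * i)))
  high-gaps i i<e g = ≰-by i (lemma w e i)
                        (even-bound {Q} {t + 1 + (w + 3 + i)} (t+1+i<1+2t (≤-trans (+-monoʳ-< (w + 3) i<e) (≤-reflexive (lemma′ w e))))
                          (subst G (cong (row Q) (lemma″ w e i)) g))
    where lemma : ∀ w e i → suc (w + 2 + e) + 3 + w + suc i ≡ suc (w + 2 + e) + 1 + (w + 3 + i)
          lemma = solve-∀
          lemma′ : ∀ w e → w + 3 + e ≡ suc (w + 2 + e)
          lemma′ = solve-∀
          lemma″ : ∀ w e i → suc (suc (suc (2 * suc (w + 2 + e)) + (2 * w + 5)) + 2 * i) ≡ 2 * (suc (w + 2 + e) + 1 + (w + 3 + i))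
          lemma″ = solve-∀
  low-run : scan (row Q R₁) ≡ pushAP 1F (scan (row Q 0)) (res Q 0) (suc (2 * w + 1))
  low-run = row-run Q 0 (2 * w + 1) (s≤s z≤n) low-members
  even-run : scan (row Q m) ≡ pushAP 2F (scan (row Q R₁)) (res Q R₁) (3 + e)
  even-run = trans (cong (scan ∘ row Q) (lemma w e)) (row-alternating Q R₁ (2 + e) (s≤s z≤n) even-members low-gaps)
    where lemma : ∀ w e → suc (2 * suc (w + 2 + e)) ≡ suc (suc (2 * w + 1) + 2 * (2 + e))
          lemma = solve-∀
  middle-run : scan (row Q R₄) ≡ pushAP 1F (scan (row Q m)) (res Q m) (suc (2 * w + 5))
  middle-run = row-run Q m (2 * w + 5) (s≤s z≤n) middle-members
  high-run : scan (row Q (2 * m)) ≡ pushAP 2F (scan (row Q R₄)) (res Q R₄) (suc e)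
  high-run = trans (cong (scan ∘ row Q) (sym (lemma w e))) (row-alternating Q R₄ e (s≤s z≤n) high-members high-gaps)
    where lemma : ∀ w e → suc (suc (suc (2 * suc (w + 2 + e)) + (2 * w + 5)) + 2 * e) ≡ 2 * suc (2 * suc (w + 2 + e))
          lemma = solve-∀

scan-row[2t+1] : ∀ t′ → let open Rows t′ in
                 scan (row (suc m) 0) ≡ pushAP 1F (pushAP 1F (scan (row m 0)) (res m 0) (suc (2 * t′))) (res m (2 * t)) (suc m)
scan-row[2t+1] t′ = begin
  scan (row (suc m) 0)                                                                     ≡⟨ row-end m ⟨
  scan (row m (2 * m))                                                                     ≡⟨ upper-run ⟩
  pushAP 1F (scan (row m (2 * t))) (res m (2 * t)) (suc m)                                 ≡⟨ cong (λ σ → pushAP 1F σ (res m (2 * t)) (suc m)) lower-run ⟩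
  pushAP 1F (pushAP 1F (scan (row m 0)) (res m 0) (suc (2 * t′))) (res m (2 * t)) (suc m)  ∎
  where
  open Rows t′
  open ≡-Reasoning
  lower-members : ∀ i → i ≤ 2 * t′ → G (row m i)
  lower-members i i≤ = ∈-lower {m} {i} (≤-trans (+-monoʳ-≤ (2 * t + 4) i≤) (≤-reflexive (lemma t′)))
    where lemma : ∀ t′ → 2 * suc t′ + 4 + 2 * t′ ≡ 2 * suc (2 * suc t′)
          lemma = solve-∀
  gap : ∀ i → i < 1 → ¬ G (row m (suc (2 * t′) + i))
  gap zero _ g = ≰-by 0 (lemma t′) (low-bound {m} {t′} (≤-refl) (subst G (cong (row m) (+-identityʳ (suc (2 * t′)))) g))
    where lemma : ∀ t′ → suc (2 * suc t′) + 1 ≡ t′ + suc t′ + 3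
          lemma = solve-∀
  gap (suc i) (s≤s ()) _
  upper-members : ∀ i → i ≤ m → G (row m (2 * t + i))
  upper-members i i≤ = ∈-upper (s≤s z≤n) {m} {2 * t + i} (m≤m+n _ i) (≤-trans (+-monoʳ-≤ (2 * t) i≤) (≤-by 2 (lemma t′)))
    where lemma : ∀ t′ → 2 * suc t′ + suc (2 * suc t′) + 2 ≡ suc (2 * suc (2 * suc t′))
          lemma = solve-∀

  lower-run : scan (row m (2 * t)) ≡ pushAP 1F (scan (row m 0)) (res m 0) (suc (2 * t′))
  lower-run = begin
    scan (row m (2 * t))                                 ≡⟨ cong (scan ∘ row m) (lemma t′) ⟩
    scan (row m (suc (2 * t′) + 1))                      ≡⟨ row-gap m (suc (2 * t′)) 1 gap ⟩
    scan (row m (suc (2 * t′)))                          ≡⟨ row-run m 0 (2 * t′) (s≤s z≤n) lower-members ⟩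
    pushAP 1F (scan (row m 0)) (res m 0) (suc (2 * t′))  ∎
    where lemma : ∀ t′ → 2 * suc t′ ≡ suc (2 * t′) + 1
          lemma = solve-∀
  upper-run : scan (row m (2 * m)) ≡ pushAP 1F (scan (row m (2 * t))) (res m (2 * t)) (suc m)
  upper-run = trans (cong (scan ∘ row m) (lemma t′)) (row-run m (2 * t) m (s≤s z≤n) upper-members)
    where lemma : ∀ t′ → 2 * suc (2 * suc t′) ≡ suc (2 * suc t′ + suc (2 * suc t′))
          lemma = solve-∀

scan-row≥2t+2 : ∀ t′ Q → let open Rows t′ in 2 * t + 2 ≤ Q →
                scan (row (suc Q) 0) ≡ pushAP 1F (scan (row Q 0)) (res Q 0) (suc (4 * t + 1))
scan-row≥2t+2 t′ Q Q≥ = begin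
  scan (row (suc Q) 0)                                    ≡⟨ row-end Q ⟨
  scan (row Q (2 * m))                                    ≡⟨ cong (scan ∘ row Q) (lemma t′) ⟩
  scan (row Q (suc (4 * t + 1)))                          ≡⟨ row-run Q 0 (4 * t + 1) (≤-trans (s≤s z≤n) Q≥) members ⟩
  pushAP 1F (scan (row Q 0)) (res Q 0) (suc (4 * t + 1))  ∎
  where
  open Rows t′
  open ≡-Reasoning
  lemma : ∀ t′ → 2 * suc (2 * suc t′) ≡ suc (4 * suc t′ + 1)
  lemma = solve-∀
  members : ∀ i → i ≤ 4 * t + 1 → G (row Q (0 + i))
  members i i≤ = row-full (s≤s z≤n) Q≥ (≤-trans (s≤s i≤) (≤-reflexive (sym (lemma t′))))

scan-row₀ : ∀ t′ → let open Rows t′ in scan (row 1 0) ≡ empty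
scan-row₀ t′ = begin
  scan (row 1 0)          ≡⟨ row-end 0 ⟨
  scan (2 * m)            ≡⟨ cong scan (lemma t′) ⟩
  scan (1 + (4 * t + 1))  ≡⟨ scan-gap 1 (4 * t + 1) gaps ⟩
  empty                   ∎
  where
  open Rows t′
  open ≡-Reasoning
  lemma : ∀ t′ → 2 * suc (2 * suc t′) ≡ 1 + (4 * suc t′ + 1)
  lemma = solve-∀
  gaps : ∀ i → i < 4 * t + 1 → ¬ G (1 + i)
  gaps i i< with 1 + i ≤? 2 * t
  ... | yes ≤2t = ∉-lower {0} {1 + i} (s≤s z≤n) ≤2t
  ... | no  ≰2t = ∉-upper (s≤s z≤n) {0} {1 + i} (<⇒≤ (≰⇒> ≰2t)) (≤-trans (s≤s i<) (≤-reflexive (sym (lemma t′))))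

-- The state at the start of row Q as a function of Q mod 3, for 1 ≤ Q ≤ t + 2, t + 3 ≤ Q ≤ 2t + 1
-- and Q ≥ 2t + 2 respectively.
early : Fin 3 → Block
early 0F = two 2F 1F
early 1F = empty
early 2F = empty

middle : Fin 3 → Block
middle 0F = one 2F
middle 1F = one 1F
middle 2F = empty

late : Fin 3 → Block
late 0F = one 2F
late 1F = empty
late 2F = two 2F 0F

pushAP-eval : ∀ d → d ≢ 0F → ∀ {σ σ′ r r′} n {c} → σ ≡ σ′ → r ≡ r′ → 2 ≤ n → n mod 3 ≡ c →
              pushAP d σ r n ≡ pushAP d σ′ r′ (rep≥2 c)
pushAP-eval d d≢0 n refl refl 2≤n refl = pushAP-reduce d d≢0 _ _ n 2≤n

1F≢0F : _≢_ {A = Fin 3} 1F 0F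
1F≢0F ()

2F≢0F : _≢_ {A = Fin 3} 2F 0F
2F≢0F ()

early-check : ∀ ρ → pushAP 2F (pushAP 2F (early ρ) (ρ ⊛ 2F ⊕ 0F) (rep≥2 (ρ ⊕ 1F))) (ρ ⊛ 2F ⊕ 1F) (rep≥2 ρ) ≡ early (ρ ⊕ 1F)
early-check 0F = refl
early-check 1F = refl
early-check 2F = refl

late-check : ∀ ρ → pushAP 1F (late ρ) (ρ ⊛ 2F ⊕ 0F) 2 ≡ late (ρ ⊕ 1F)
late-check 0F = refl
late-check 1F = refl
late-check 2F = refl

middle-check : ∀ ω ε → ω ⊕ ε ≡ 0F →
         pushAP 2F (pushAP 1F (pushAP 2F (pushAP 1F (middle ω) (ω ⊛ 2F ⊕ 0F) (rep≥2 (2F ⊛ ω ⊕ 2F))) (ω ⊛ 2F ⊕ (2F ⊛ ω ⊕ 2F)) (rep≥2 ε))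
                              (ω ⊛ 2F ⊕ 1F) (rep≥2 (2F ⊛ ω)))
                   (ω ⊛ 2F ⊕ (1F ⊕ 2F ⊛ ω)) (rep≥2 (ε ⊕ 1F))
         ≡ middle (ω ⊕ 1F)
middle-check 0F 0F _ = refl
middle-check 1F 2F _ = refl
middle-check 2F 1F _ = refl
middle-check 0F 1F ()
middle-check 0F 2F ()
middle-check 1F 0F ()
middle-check 1F 1F ()
middle-check 2F 0F ()
middle-check 2F 2F ()

late-unbroken : ∀ ρ → late ρ ≢ broken
late-unbroken 0F ()
late-unbroken 1F ()
late-unbroken 2F ()

-- t = 3(n + 1)
module ThreePermutation (n : ℕ) where

  open Rows (2 + 3 * n)

  t-mod : t mod 3 ≡ 0F
  t-mod = trans (mod-3+ (3 * n)) (mod-* 3 n)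

  2t-mod : (2 * t) mod 3 ≡ 0F
  2t-mod = trans (mod-* 2 t) (cong (2F ⊛_) t-mod)

  m-mod : m mod 3 ≡ 1F
  m-mod = trans (mod-+ 1 (2 * t)) (cong (1F ⊕_) 2t-mod)

  res≡ : ∀ Q R {ρ r} → Q mod 3 ≡ ρ → R mod 3 ≡ r → res Q R ≡ ρ ⊛ 2F ⊕ r
  res≡ Q R refl refl = trans (mod-+ (Q * (2 * m)) R) (cong (_⊕ R mod 3) (trans (mod-* Q (2 * m)) (cong (Q mod 3 ⊛_) 2m-mod)))
    where 2m-mod : (2 * m) mod 3 ≡ 2F
          2m-mod = trans (mod-* 2 m) (cong (2F ⊛_) m-mod)

  t+-mod : ∀ x → (t + x) mod 3 ≡ x mod 3
  t+-mod x = trans (mod-+ t x) (trans (cong (_⊕ x mod 3) t-mod) (toℕ-mod-id (x mod 3)))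

  +t-mod : ∀ c → (c + t) mod 3 ≡ c mod 3
  +t-mod c = trans (cong (_mod 3) (+-comm c t)) (t+-mod c)

  2+m-mod : (2 + m) mod 3 ≡ 0F
  2+m-mod = trans (mod-2+ m) (cong (_⊕ 2F) m-mod)

  2≤t : 2 ≤ t
  2≤t = s≤s (s≤s z≤n)

  early-step : ∀ q d → q + d ≡ 2 + 3 * n → scan (row (1 + q) 0) ≡ early ((1 + q) mod 3) → scan (row (2 + q) 0) ≡ early ((2 + q) mod 3)
  early-step zero d eq start = begin
    scan (row 2 0)
      ≡⟨ scan-row≤t 0 d eq ⟩
    pushAP 2F (pushAP 2F (scan (row 1 0)) (res 1 0) 2) (res 1 m) 1
      ≡⟨ cong₂ (λ σ r → pushAP 2F σ r 1) (cong₂ (λ σ r → pushAP 2F σ r 2) start (res≡ 1 0 refl refl)) (res≡ 1 m refl m-mod) ⟩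
    early 2F ∎
    where open ≡-Reasoning
  early-step (suc q) d eq start = begin
    scan (row (3 + q) 0)
      ≡⟨ scan-row≤t (suc q) d eq ⟩
    pushAP 2F (pushAP 2F (scan (row Q 0)) (res Q 0) (suc Q)) (res Q m) Q
      ≡⟨ pushAP-eval 2F 2F≢0F Q (pushAP-eval 2F 2F≢0F (suc Q) start (res≡ Q 0 refl refl) (s≤s (s≤s z≤n)) (mod-suc Q))
                                (res≡ Q m refl m-mod) (s≤s (s≤s z≤n)) refl ⟩
    pushAP 2F (pushAP 2F (early ρ) (ρ ⊛ 2F ⊕ 0F) (rep≥2 (ρ ⊕ 1F))) (ρ ⊛ 2F ⊕ 1F) (rep≥2 ρ)
      ≡⟨ early-check ρ ⟩
    early (ρ ⊕ 1F)
      ≡⟨ cong early (mod-suc Q) ⟨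
    early ((3 + q) mod 3) ∎
    where
    open ≡-Reasoning
    Q = 2 + q
    ρ = Q mod 3

  early-step[t+1] : scan (row (1 + t) 0) ≡ early 1F → scan (row (2 + t) 0) ≡ early 2F
  early-step[t+1] start = begin
    scan (row (2 + t) 0)
      ≡⟨ scan-row[t+1] (2 + 3 * n) ⟩
    pushAP 2F (pushAP 1F (pushAP 2F (scan (row (1 + t) 0)) (res (1 + t) 0) (suc t)) (res (1 + t) m) 2) (res (1 + t) (2 + m)) t
      ≡⟨ pushAP-eval 2F 2F≢0F t (pushAP-eval 1F 1F≢0F 2 (pushAP-eval 2F 2F≢0F (suc t) start r₀ (m≤n⇒m≤1+n 2≤t) (+t-mod 1)) r₁ ≤-refl refl) r₂ 2≤t t-mod ⟩
    pushAP 2F (pushAP 1F (pushAP 2F (early 1F) 2F 4) 0F 2) 2F 3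
      ≡⟨⟩
    early 2F ∎
    where
    open ≡-Reasoning
    r₀ : res (1 + t) 0 ≡ 2F
    r₀ = res≡ (1 + t) 0 (+t-mod 1) refl
    r₁ : res (1 + t) m ≡ 0F
    r₁ = res≡ (1 + t) m (+t-mod 1) m-mod
    r₂ : res (1 + t) (2 + m) ≡ 2F
    r₂ = res≡ (1 + t) (2 + m) (+t-mod 1) 2+m-mod

  early⇒middle : scan (row (2 + t) 0) ≡ early 2F → scan (row (3 + t) 0) ≡ middle 0F
  early⇒middle start = begin
    scan (row (3 + t) 0)
      ≡⟨ scan-row[t+2] (1 + 3 * n) ⟩
    pushAP 2F (pushAP 1F (pushAP 2F (scan (row (2 + t) 0)) (res (2 + t) 0) (suc t)) (res (2 + t) m) 4) (res (2 + t) (4 + m)) (2 + 3 * n)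
      ≡⟨ pushAP-eval 2F 2F≢0F (2 + 3 * n) (pushAP-eval 1F 1F≢0F 4 (pushAP-eval 2F 2F≢0F (suc t) start r₀ (m≤n⇒m≤1+n 2≤t) (+t-mod 1)) r₁ (s≤s (s≤s z≤n)) refl)
                    r₂ (s≤s (s≤s z≤n)) (trans (mod-2+ (3 * n)) (cong (_⊕ 2F) (mod-* 3 n))) ⟩
    pushAP 2F (pushAP 1F (pushAP 2F (early 2F) 1F 4) 2F 4) 0F 2
      ≡⟨⟩
    middle 0F ∎
    where
    open ≡-Reasoning
    r₀ : res (2 + t) 0 ≡ 1F
    r₀ = res≡ (2 + t) 0 (+t-mod 2) refl
    r₁ : res (2 + t) m ≡ 2F
    r₁ = res≡ (2 + t) m (+t-mod 2) m-mod
    r₂ : res (2 + t) (4 + m) ≡ 0F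
    r₂ = res≡ (2 + t) (4 + m) (+t-mod 2) (trans (mod-3+ (1 + m)) (trans (mod-suc m) (cong (_⊕ 1F) m-mod)))

  module MiddleRow (w e : ℕ) {ω} (w-mod : w mod 3 ≡ ω) (start : scan (row (t + 3 + w) 0) ≡ middle ω) where

    Q = t + 3 + w

    Q-mod : Q mod 3 ≡ ω
    Q-mod = trans (cong (_mod 3) (+-assoc t 3 w)) (trans (t+-mod (3 + w)) (trans (mod-3+ w) w-mod))

    2w-mod : (2 * w) mod 3 ≡ 2F ⊛ ω
    2w-mod = trans (mod-* 2 w) (cong (2F ⊛_) w-mod)

    c₁ : suc (2 * w + 1) mod 3 ≡ 2F ⊛ ω ⊕ 2F
    c₁ = trans (cong (_mod 3) (lemma w)) (trans (mod-2+ (2 * w)) (cong (_⊕ 2F) 2w-mod))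
      where lemma : ∀ w → suc (2 * w + 1) ≡ 2 + 2 * w
            lemma = solve-∀

    c₃ : suc (2 * w + 5) mod 3 ≡ 2F ⊛ ω
    c₃ = trans (cong (_mod 3) (lemma w)) (trans (mod-3+ (3 + 2 * w)) (trans (mod-3+ (2 * w)) 2w-mod))
      where lemma : ∀ w → suc (2 * w + 5) ≡ 3 + (3 + 2 * w)
            lemma = solve-∀

    first-three : pushAP 1F (pushAP 2F (pushAP 1F (scan (row Q 0)) (res Q 0) (suc (2 * w + 1))) (res Q (suc (2 * w + 1))) (3 + e))
                            (res Q m) (suc (2 * w + 5))
                ≡ pushAP 1F (pushAP 2F (pushAP 1F (middle ω) (ω ⊛ 2F ⊕ 0F) (rep≥2 (2F ⊛ ω ⊕ 2F))) (ω ⊛ 2F ⊕ (2F ⊛ ω ⊕ 2F)) (rep≥2 (e mod 3)))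
                            (ω ⊛ 2F ⊕ 1F) (rep≥2 (2F ⊛ ω))
    first-three =
      pushAP-eval 1F 1F≢0F (suc (2 * w + 5))
        (pushAP-eval 2F 2F≢0F (3 + e)
          (pushAP-eval 1F 1F≢0F (suc (2 * w + 1)) start (res≡ Q 0 Q-mod refl) (s≤s (m≤n+m 1 (2 * w))) c₁)
          (res≡ Q (suc (2 * w + 1)) Q-mod c₁) (s≤s (s≤s z≤n)) (mod-3+ e))
        (res≡ Q m Q-mod m-mod) (s≤s (≤-trans (s≤s z≤n) (m≤n+m 5 (2 * w)))) c₃

    r₄ : res Q (suc (m + (2 * w + 5))) ≡ ω ⊛ 2F ⊕ (1F ⊕ 2F ⊛ ω)
    r₄ = res≡ Q _ Q-mod (begin
      suc (m + (2 * w + 5)) mod 3              ≡⟨ cong (_mod 3) (lemma t w) ⟩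
      (3 + (3 + (2 * t + (1 + 2 * w)))) mod 3  ≡⟨ trans (mod-3+ (3 + (2 * t + (1 + 2 * w)))) (mod-3+ (2 * t + (1 + 2 * w))) ⟩
      (2 * t + (1 + 2 * w)) mod 3              ≡⟨ mod-+ (2 * t) (1 + 2 * w) ⟩
      (2 * t) mod 3 ⊕ (1 + 2 * w) mod 3        ≡⟨ cong₂ _⊕_ 2t-mod (trans (mod-+ 1 (2 * w)) (cong (1F ⊕_) 2w-mod)) ⟩
      0F ⊕ (1F ⊕ 2F ⊛ ω)                       ≡⟨ toℕ-mod-id (1F ⊕ 2F ⊛ ω) ⟩
      1F ⊕ 2F ⊛ ω                              ∎)
      where
      open ≡-Reasoning
      lemma : ∀ t w → suc (suc (2 * t) + (2 * w + 5)) ≡ 3 + (3 + (2 * t + (1 + 2 * w)))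
      lemma = solve-∀

  middle-step : ∀ w e → w + 2 + e ≡ 2 + 3 * n → scan (row (t + 3 + w) 0) ≡ middle (w mod 3) →
                scan (row (suc (t + 3 + w)) 0) ≡ middle (suc w mod 3)
  -- for e = 0 the last run is a single member, and w ≡ 0 (mod 3) fixes the state
  middle-step w zero eq start = begin
    scan (row (suc (t + 3 + w)) 0)
      ≡⟨ trans (scan-row[t+3+w] w 0 eq) (cong₂ (λ σ r → pushAP 2F σ r 1) first-three r₄) ⟩
    middle 1F
      ≡⟨ cong middle (trans (mod-suc w) (cong (_⊕ 1F) w≡0)) ⟨
    middle (suc w mod 3) ∎
    where
    open ≡-Reasoning
    w≡0 : w mod 3 ≡ 0F
    w≡0 = trans (cong (_mod 3) (+-cancelˡ-≡ 2 w (3 * n) (trans (lemma w) eq))) (mod-* 3 n)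
      where lemma : ∀ w → 2 + w ≡ w + 2 + 0
            lemma = solve-∀
    open MiddleRow w 0 w≡0 (trans start (cong middle w≡0))
  middle-step w (suc e) eq start = begin
    scan (row (suc (t + 3 + w)) 0)
      ≡⟨ trans (scan-row[t+3+w] w (suc e) eq)
               (trans (pushAP-eval 2F 2F≢0F (suc (suc e)) first-three r₄ (s≤s (s≤s z≤n)) (mod-suc (suc e)))
                      (middle-check (w mod 3) (suc e mod 3) sum≡0)) ⟩
    middle (w mod 3 ⊕ 1F)
      ≡⟨ cong middle (mod-suc w) ⟨
    middle (suc w mod 3) ∎
    where
    open ≡-Reasoning
    open MiddleRow w (suc e) refl start
    sum≡0 : w mod 3 ⊕ suc e mod 3 ≡ 0F
    sum≡0 = trans (sym (mod-+ w (suc e))) (trans (cong (_mod 3) (+-cancelˡ-≡ 2 _ _ (trans (lemma w e) eq))) (mod-* 3 n))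
      where lemma : ∀ w e → 2 + (w + suc e) ≡ w + 2 + suc e
            lemma = solve-∀

  middle⇒late : scan (row m 0) ≡ middle 1F → scan (row (suc m) 0) ≡ late 2F
  middle⇒late start = begin
    scan (row (suc m) 0)
      ≡⟨ scan-row[2t+1] (2 + 3 * n) ⟩
    pushAP 1F (pushAP 1F (scan (row m 0)) (res m 0) (suc (2 * (2 + 3 * n)))) (res m (2 * t)) (suc m)
      ≡⟨ pushAP-eval 1F 1F≢0F (suc m) (pushAP-eval 1F 1F≢0F (suc (2 * (2 + 3 * n))) start r₀ (s≤s (s≤s z≤n)) c₀) r₁ (s≤s (s≤s z≤n)) (trans (mod-suc m) (cong (_⊕ 1F) m-mod)) ⟩
    pushAP 1F (pushAP 1F (middle 1F) 2F 2) 2F 2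
      ≡⟨⟩
    late 2F ∎
    where
    open ≡-Reasoning
    r₀ : res m 0 ≡ 2F
    r₀ = res≡ m 0 m-mod refl
    r₁ : res m (2 * t) ≡ 2F
    r₁ = res≡ m (2 * t) m-mod 2t-mod
    c₀ : suc (2 * (2 + 3 * n)) mod 3 ≡ 2F
    c₀ = trans (cong (_mod 3) (lemma n)) (trans (mod-2+ (3 * (1 + 2 * n))) (cong (_⊕ 2F) (mod-* 3 (1 + 2 * n))))
      where lemma : ∀ n → suc (2 * (2 + 3 * n)) ≡ 2 + 3 * (1 + 2 * n)
            lemma = solve-∀

  late-step : ∀ Q → 2 * t + 2 ≤ Q → scan (row Q 0) ≡ late (Q mod 3) → scan (row (suc Q) 0) ≡ late (suc Q mod 3)
  late-step Q Q≥ start = begin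
    scan (row (suc Q) 0)                                    ≡⟨ scan-row≥2t+2 (2 + 3 * n) Q Q≥ ⟩
    pushAP 1F (scan (row Q 0)) (res Q 0) (suc (4 * t + 1))  ≡⟨ pushAP-eval 1F 1F≢0F (suc (4 * t + 1)) start (res≡ Q 0 refl refl) (s≤s (s≤s z≤n)) c ⟩
    pushAP 1F (late (Q mod 3)) (Q mod 3 ⊛ 2F ⊕ 0F) 2        ≡⟨ late-check (Q mod 3) ⟩
    late (Q mod 3 ⊕ 1F)                                     ≡⟨ cong late (mod-suc Q) ⟨
    late (suc Q mod 3)                                      ∎
    where
    open ≡-Reasoning
    c : suc (4 * t + 1) mod 3 ≡ 2F
    c = trans (cong (_mod 3) (lemma t)) (trans (mod-2+ (4 * t)) (cong (_⊕ 2F) (trans (mod-* 4 t) (cong (1F ⊛_) t-mod))))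
      where lemma : ∀ t → suc (4 * t + 1) ≡ 2 + 4 * t
            lemma = solve-∀

  scan-early : ∀ q → q ≤ t → scan (row (suc q) 0) ≡ early (suc q mod 3)
  scan-early zero    _     = scan-row₀ (2 + 3 * n)
  scan-early (suc q) sq≤t  = early-step q (2 + 3 * n ∸ q) (m+[n∸m]≡n (≤-pred sq≤t)) (scan-early q (≤-trans (n≤1+n q) sq≤t))

  scan-row[t+3] : scan (row (3 + t) 0) ≡ middle 0F
  scan-row[t+3] = early⇒middle (early-step[t+1] (trans (scan-early t ≤-refl) (cong early (+t-mod 1))))

  scan-middle : ∀ w → w ≤ suc (3 * n) → scan (row (t + 3 + w) 0) ≡ middle (w mod 3)
  scan-middle zero    _      = trans (cong (λ Q → scan (row Q 0)) (lemma t)) scan-row[t+3]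
    where lemma : ∀ t → t + 3 + 0 ≡ 3 + t
          lemma = solve-∀
  scan-middle (suc w) sw≤   = trans (cong (λ Q → scan (row Q 0)) (+-suc (t + 3) w))
                               (middle-step w (3 * n ∸ w) eq (scan-middle w (≤-trans (n≤1+n w) sw≤)))
    where eq : w + 2 + (3 * n ∸ w) ≡ 2 + 3 * n
          eq = trans (trans (+-assoc w 2 _) (+-comm w _)) (trans (+-assoc 2 _ w) (cong (2 +_) (m∸n+n≡m (≤-pred sw≤))))

  scan-row[m] : scan (row m 0) ≡ middle 1F
  scan-row[m] = trans (cong (λ Q → scan (row Q 0)) (lemma n)) (trans (scan-middle (suc (3 * n)) ≤-refl) (cong middle (trans (mod-suc (3 * n)) (cong (_⊕ 1F) (mod-* 3 n)))))
    where lemma : ∀ n → suc (2 * suc (2 + 3 * n)) ≡ suc (2 + 3 * n) + 3 + suc (3 * n)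
          lemma = solve-∀

  scan-late : ∀ j → scan (row (suc m + j) 0) ≡ late ((suc m + j) mod 3)
  scan-late zero    = trans (cong (λ Q → scan (row Q 0)) (+-identityʳ (suc m)))
                         (trans (middle⇒late scan-row[m]) (cong late (sym (trans (cong (_mod 3) (+-identityʳ (suc m))) (trans (mod-suc m) (cong (_⊕ 1F) m-mod))))))
  scan-late (suc j) = trans (cong (λ Q → scan (row Q 0)) (+-suc (suc m) j))
                         (trans (late-step (suc m + j) (≤-trans (≤-reflexive (+-comm (2 * t) 2)) (m≤m+n (suc m) j)) (scan-late j))
                                (cong late (cong (_mod 3) (sym (+-suc (suc m) j)))))

  scan-unbroken : ∀ x → ∃ λ y → x ≤ y × scan y ≢ broken
  scan-unbroken x = row (suc m + x) 0 , x≤ , λ b → late-unbroken _ (trans (sym (scan-late x)) b)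
    where x≤ : x ≤ row (suc m + x) 0
          x≤ = ≤-trans (m≤n+m x (suc m)) (≤-trans (m≤m*n (suc m + x) (2 * m)) (m≤m+n _ 0))

  ∉-below-2m : ∀ z → 0 < z → z < 2 * m → ¬ G z
  ∉-below-2m z 0<z z<2m with z ≤? 2 * t
  ... | yes z≤2t = ∉-lower {0} {z} 0<z z≤2t
  ... | no  z≰2t = ∉-upper (s≤s z≤n) {0} {z} (<⇒≤ (≰⇒> z≰2t)) z<2m

  ∉-2m+1 : ¬ G (suc (2 * m))
  ∉-2m+1 g = ≰-by (t + 1) (lemma t) (low-bound {1} {0} (s≤s z≤n) (subst G (sym (trans (+-comm (1 * (2 * m)) 1) (cong suc (*-identityˡ (2 * m))))) g))
    where lemma : ∀ t → 1 + suc (t + 1) ≡ 0 + t + 3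
          lemma = solve-∀

  ∉-between-2m+2-3m : ∀ z → 2 * m + 2 < z → z < 3 * m → ¬ G z
  ∉-between-2m+2-3m z lo hi with d , refl ← m≤n⇒∃[o]m+o≡n (≤-trans (m≤m+n (2 * m) 2) (<⇒≤ lo)) =
    ∉-lower {1} {d} (+-cancelˡ-< (2 * m) 2 d lo) (≤-pred (+-cancelˡ-< (2 * m) d m (≤-trans hi (≤-reflexive (lemma m)))))
      ∘ subst G (cong (_+ d) (sym (*-identityˡ (2 * m))))
    where lemma : ∀ m → 3 * m ≡ 2 * m + m
          lemma = solve-∀

  enum-1 : enum 1 ≡ 2 * m
  enum-1 = next-char 0 (2 * m) (s≤s z≤n) (⟨⟩-generator gens 0F) ∉-below-2m

  enum-2 : enum 2 ≡ 2 * m + 2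
  enum-2 = trans (cong next enum-1) (next-char (2 * m) (2 * m + 2) (m<m+n (2 * m) (s≤s z≤n)) (⟨⟩-generator gens 1F) between)
    where between : ∀ z → 2 * m < z → z < 2 * m + 2 → ¬ G z
          between z lo hi = ∉-2m+1 ∘ subst G (≤-antisym (≤-pred (≤-trans hi (≤-reflexive (+-comm (2 * m) 2)))) lo)

  enum-3 : enum 3 ≡ 3 * m
  enum-3 = trans (cong next enum-2) (next-char (2 * m + 2) (3 * m) (≤-by (2 * (2 + 3 * n)) (lemma (2 + 3 * n))) (⟨⟩-generator gens 2F) ∉-between-2m+2-3m)
    where lemma : ∀ t′ → suc (2 * suc (2 * suc t′) + 2) + 2 * t′ ≡ 3 * suc (2 * suc t′)
          lemma = solve-∀

  isPermutationNS : IsPermutationNS 3 G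
  isPermutationNS = (⟨⟩-zero gens , ⟨⟩-+ gens , _ , cofinite (s≤s z≤n)) ,
                    enum , enumerates (⟨⟩-zero gens) , ⟨⟩-cong gens≗enum , scan-permutation (⟨⟩-zero gens) scan-unbroken
    where gens≗enum : ∀ i → gens i ≡ enum (suc (toℕ i))
          gens≗enum 0F = sym enum-1
          gens≗enum 1F = sym enum-2
          gens≗enum 2F = sym enum-3

lemma4p8 : (k : ℕ) → 1 ≤ k → IsPermutationNS 3 ⟨ gensS k ⟩
lemma4p8 (suc n) _ = IsPermutationNS-resp (⟨⟩-cong gens≗gensS) isPermutationNS
  where
  open ThreePermutation n
  open Rows (2 + 3 * n) using (gens)
  gens≗gensS : ∀ i → gens i ≡ gensS (suc n) i
  gens≗gensS 0F = lemma n
    where lemma : ∀ n → 2 * suc (2 * suc (2 + 3 * n)) ≡ 12 * suc n + 2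
          lemma = solve-∀
  gens≗gensS 1F = lemma n
    where lemma : ∀ n → 2 * suc (2 * suc (2 + 3 * n)) + 2 ≡ 12 * suc n + 4
          lemma = solve-∀
  gens≗gensS 2F = lemma n
    where lemma : ∀ n → 3 * suc (2 * suc (2 + 3 * n)) ≡ 18 * suc n + 3
          lemma = solve-∀
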